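{- Let $H$ be a random bipartite graph with vertex classes $X$ and $Y$, $|X|=|Y|=n$, formed by taking the union of $25$ independent uniformly random perfect matchings between $X$ and $Y$. Then, with probability $1-o(n^{ -2})$, the following hold: (i) every $A\subset X$ with $|A|\le n/4$ satisfies $|N(A)|\ge 2|A|$; (ii) every $B\subset Y$ with $|B|\le n/4$ satisfies $|N(B)|\ge 2|B|$; (iii) for every $A\subset X$ and $B\subset Y$ with $|A|,|B|\ge n/5$ there is an edge of $H$ between $A$ and $B$.
   Context: $N(A)$ is the set of vertices of $H$ adjacent to some vertex of $A$; $o(\cdot)$ refers to $n\to\infty$. -}

module Defs where

open import Data.Nat using (ℕ; zero; suc; _*_; _≤_)
open import Data.Bool using (Bool; true; false; _∧_; _∨_; not; if_then_else_)
open import Data.Fin using (Fin; _≟_)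
open import Data.Fin.Subset using (Subset; ∣_∣)
open import Data.List using (List; []; _∷_; concatMap; map; filterᵇ; length)
open import Data.Bool.ListAction using (all; any)
open import Data.List using () renaming (allFin to allFinL)
open import Data.Vec using (Vec; []; _∷_; lookup; toList)
open import Relation.Nullary.Decidable using (⌊_⌋)

allVecs : {A : Set} → List A → (k : ℕ) → List (Vec A k)
allVecs xs zero = [] ∷ []
allVecs xs (suc k) = concatMap (λ x → map (x ∷_) (allVecs xs k)) xs

anyF : {n : ℕ} → (Fin n → Bool) → Bool
anyF {n} p = any p (allFinL n)

allF : {n : ℕ} → (Fin n → Bool) → Bool
allF {n} p = all p (allFinL n)

allSubsets : (n : ℕ) → List (Subset n)
allSubsets n = allVecs (true ∷ false ∷ []) n

-- a map Fin n → Fin n (as a vector of images) is a bijection iff injective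
injectiveᵇ : {n : ℕ} → Vec (Fin n) n → Bool
injectiveᵇ {n} σ = allF λ i → allF λ j → not ⌊ lookup σ i ≟ lookup σ j ⌋ ∨ ⌊ i ≟ j ⌋

-- all perfect matchings between X = Fin n and Y = Fin n (= permutations: x ↦ σ x)
perfectMatchings : (n : ℕ) → List (Vec (Fin n) n)
perfectMatchings n = filterᵇ injectiveᵇ (allVecs (allFinL n) n)

-- H is given by 25 perfect matchings (the union of them); sample space
Matchings : ℕ → Set
Matchings n = Vec (Vec (Fin n) n) 25

sampleSpace : (n : ℕ) → List (Matchings n)
sampleSpace n = allVecs (perfectMatchings n) 25

edgeᵇ : {n : ℕ} → Matchings n → Fin n → Fin n → Bool
edgeᵇ M x y = anyF λ i → ⌊ lookup (lookup M i) x ≟ y ⌋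

NX : {n : ℕ} → Matchings n → Subset n → Subset n
NX {n} M A = Data.Vec.tabulate λ y → anyF λ x → lookup A x ∧ edgeᵇ M x y

NY : {n : ℕ} → Matchings n → Subset n → Subset n
NY {n} M B = Data.Vec.tabulate λ x → anyF λ y → lookup B y ∧ edgeᵇ M x y

_≤ᵇ_ : ℕ → ℕ → Bool
m ≤ᵇ n = Data.Nat._≤ᵇ_ m n

infix 4 _≤ᵇ_

prop-i : {n : ℕ} → Matchings n → Bool
prop-i {n} M = all (λ A → not ((4 * ∣ A ∣) ≤ᵇ n) ∨ ((2 * ∣ A ∣) ≤ᵇ ∣ NX M A ∣)) (allSubsets n)

prop-ii : {n : ℕ} → Matchings n → Bool
prop-ii {n} M = all (λ B → not ((4 * ∣ B ∣) ≤ᵇ n) ∨ ((2 * ∣ B ∣) ≤ᵇ ∣ NY M B ∣)) (allSubsets n)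

prop-iii : {n : ℕ} → Matchings n → Bool
prop-iii {n} M = all (λ A → all (λ B →
    not ((n ≤ᵇ (5 * ∣ A ∣)) ∧ (n ≤ᵇ (5 * ∣ B ∣)))
    ∨ (anyF λ x → anyF λ y → lookup A x ∧ lookup B y ∧ edgeᵇ M x y))
  (allSubsets n)) (allSubsets n)

good : {n : ℕ} → Matchings n → Bool
good M = prop-i M ∧ prop-ii M ∧ prop-iii M

badCount : ℕ → ℕ
badCount n = length (filterᵇ (λ M → not (good M)) (sampleSpace n))

totalCount : ℕ → ℕ
totalCount n = length (sampleSpace n)

module Submission where

-- A union bound over witnesses. If (i) fails there are A with ∣ A ∣ = s, 1 ≤ s ≤ n/4, and a set T ⊇ N(A)
-- of size 2s − 1, so all 25 matchings map A into T; (ii) is the same after passing to complements, and if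
-- (iii) fails there are A, B of size ⌈n/5⌉ such that all matchings map A into Y ∖ B. A permutation maps a
-- given a-set into a given t-set in (t)ₐ · (n − a)! ways, so the bad outcomes number at most
-- Σ₁ + Σ₂ + Σ₃, against (n!)²⁵ outcomes in total. Using C(n,s)·(t)ₛ(n − s)! = n!·C(t,s) and
-- (t)ₛ(n − s)! ≤ n!·(t/n)ˢ, the s-th term of Σ₁ = Σ₂ is at most 64 (n!)²⁵ / (n³ 2ˢ), so Σ₁ ≤ 64 (n!)²⁵ / n³;
-- with C(4m, m) ≤ 10ᵐ one gets Σ₃ ≤ (n!)²⁵ (2/3)ᵐ for m = ⌈n/5⌉. Hence (k + 1) n² (2 Σ₁ + Σ₃) ≤ (n!)²⁵
-- once n ≥ 5250 (k + 1).

open import Data.Bool using (Bool; true; false; _∧_; _∨_; not; if_then_else_; T)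
open import Data.Bool.ListAction using (all; any)
open import Data.Bool.Properties using (∧-identityʳ; ∧-zeroʳ; ∨-zeroʳ; not-injective)
open import Data.Empty using (⊥-elim)
open import Data.Fin using (Fin; zero; suc; _≟_)
import Data.Fin.Properties as Finₚ
open import Data.Fin.Subset using (Subset; ∣_∣; ∁)
open import Data.Fin.Subset.Properties using (∣∁p∣≡n∸∣p∣; ∣p∣≤n; ∣⊥∣≡0)
open import Data.List using (List; []; _∷_; concatMap; map; filterᵇ; length; _++_; tabulate; allFin)
open import Data.Nat using (ℕ; zero; suc; _+_; _*_; _∸_; _^_; _≤_; _<_; z≤n; s≤s; _!; _≡ᵇ_; NonZero; >-nonZero)
open import Data.Nat.Properties hiding (_≟_)
open import Data.Nat.Tactic.RingSolver
open import Data.Product using (∃; _,_; _×_; proj₁; proj₂)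
open import Data.Sum using (inj₁; inj₂)
open import Data.Unit using (tt)
open import Data.Vec using (Vec; []; _∷_; lookup; replicate)
open import Data.Vec.Properties using (lookup∘tabulate)
open import Function using (case_of_)
open import Relation.Binary.PropositionalEquality
open import Relation.Nullary using (¬_; yes; no)
open import Relation.Nullary.Decidable using (⌊_⌋)
open import Defs

count : {A : Set} → (A → Bool) → List A → ℕ
count p [] = 0
count p (x ∷ xs) = if p x then suc (count p xs) else count p xs

sumBy : {A : Set} → (A → ℕ) → List A → ℕ
sumBy f [] = 0
sumBy f (x ∷ xs) = f x + sumBy f xs

𝟙 : Bool → ℕ
𝟙 true = 1
𝟙 false = 0

∧-elimˡ : ∀ {a b} → a ∧ b ≡ true → a ≡ true
∧-elimˡ {true} _ = refl

∧-elimʳ : ∀ {a b} → a ∧ b ≡ true → b ≡ true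
∧-elimʳ {true} e = e

∧-intro : ∀ {a b} → a ≡ true → b ≡ true → a ∧ b ≡ true
∧-intro refl refl = refl

length-filterᵇ : {A : Set} (p : A → Bool) (xs : List A) → length (filterᵇ p xs) ≡ count p xs
length-filterᵇ p [] = refl
length-filterᵇ p (x ∷ xs) with p x
... | true = cong suc (length-filterᵇ p xs)
... | false = length-filterᵇ p xs

length≡count-true : {A : Set} (xs : List A) → length xs ≡ count (λ _ → true) xs
length≡count-true [] = refl
length≡count-true (x ∷ xs) = cong suc (length≡count-true xs)

count-filterᵇ : {A : Set} (p q : A → Bool) (xs : List A) →
  count q (filterᵇ p xs) ≡ count (λ x → p x ∧ q x) xs
count-filterᵇ p q [] = refl
count-filterᵇ p q (x ∷ xs) with p x
... | true = cong (λ z → if q x then suc z else z) (count-filterᵇ p q xs)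
... | false = count-filterᵇ p q xs

count≡sumBy-𝟙 : {A : Set} (p : A → Bool) (xs : List A) → count p xs ≡ sumBy (λ x → 𝟙 (p x)) xs
count≡sumBy-𝟙 p [] = refl
count≡sumBy-𝟙 p (x ∷ xs) with p x
... | true = cong suc (count≡sumBy-𝟙 p xs)
... | false = count≡sumBy-𝟙 p xs

count-mono : {A : Set} (p q : A → Bool) (xs : List A) →
  (∀ x → p x ≡ true → q x ≡ true) → count p xs ≤ count q xs
count-mono p q [] h = z≤n
count-mono p q (x ∷ xs) h with p x in px | q x in qx
... | true | true = s≤s (count-mono p q xs h)
... | true | false with () ← trans (sym (h x px)) qx
... | false | true = m≤n⇒m≤1+n (count-mono p q xs h)
... | false | false = count-mono p q xs h

count-cong : {A : Set} (p q : A → Bool) (xs : List A) → (∀ x → p x ≡ q x) → count p xs ≡ count q xs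
count-cong p q xs h =
  ≤-antisym (count-mono p q xs (λ x e → trans (sym (h x)) e)) (count-mono q p xs (λ x e → trans (h x) e))

count-const-∧ : {A : Set} (b : Bool) (q : A → Bool) (xs : List A) →
  count (λ x → b ∧ q x) xs ≡ 𝟙 b * count q xs
count-const-∧ true q xs = sym (+-identityʳ _)
count-const-∧ false q [] = refl
count-const-∧ false q (x ∷ xs) = count-const-∧ false q xs

union-bound : {A : Set} (p : A → Bool) (Φ : A → ℕ) (xs : List A) →
  (∀ x → p x ≡ true → 1 ≤ Φ x) → count p xs ≤ sumBy Φ xs
union-bound p Φ [] h = z≤n
union-bound p Φ (x ∷ xs) h with p x in px
... | true = +-mono-≤ (h x px) (union-bound p Φ xs h)
... | false = ≤-trans (union-bound p Φ xs h) (m≤n+m _ (Φ x))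

sumBy-0 : {A : Set} (xs : List A) → sumBy (λ _ → 0) xs ≡ 0
sumBy-0 [] = refl
sumBy-0 (x ∷ xs) = sumBy-0 xs

sumBy-cong : {A : Set} {f g : A → ℕ} (xs : List A) → (∀ x → f x ≡ g x) → sumBy f xs ≡ sumBy g xs
sumBy-cong [] e = refl
sumBy-cong (x ∷ xs) e = cong₂ _+_ (e x) (sumBy-cong xs e)

sumBy-mono-≤ : {A : Set} {f g : A → ℕ} (xs : List A) → (∀ x → f x ≤ g x) → sumBy f xs ≤ sumBy g xs
sumBy-mono-≤ [] e = z≤n
sumBy-mono-≤ (x ∷ xs) e = +-mono-≤ (e x) (sumBy-mono-≤ xs e)

sumBy-++ : {A : Set} (f : A → ℕ) (xs ys : List A) → sumBy f (xs ++ ys) ≡ sumBy f xs + sumBy f ys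
sumBy-++ f [] ys = refl
sumBy-++ f (x ∷ xs) ys = trans (cong (f x +_) (sumBy-++ f xs ys)) (sym (+-assoc (f x) _ _))

sumBy-map : {A B : Set} (f : B → ℕ) (g : A → B) (xs : List A) →
  sumBy f (map g xs) ≡ sumBy (λ x → f (g x)) xs
sumBy-map f g [] = refl
sumBy-map f g (x ∷ xs) = cong (f (g x) +_) (sumBy-map f g xs)

sumBy-concatMap : {A B : Set} (f : B → ℕ) (g : A → List B) (xs : List A) →
  sumBy f (concatMap g xs) ≡ sumBy (λ x → sumBy f (g x)) xs
sumBy-concatMap f g [] = refl
sumBy-concatMap f g (x ∷ xs) =
  trans (sumBy-++ f (g x) _) (cong (sumBy f (g x) +_) (sumBy-concatMap f g xs))

sumBy-+ : {A : Set} (f g : A → ℕ) (xs : List A) →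
  sumBy (λ x → f x + g x) xs ≡ sumBy f xs + sumBy g xs
sumBy-+ f g [] = refl
sumBy-+ f g (x ∷ xs) rewrite sumBy-+ f g xs = interchange (f x) (g x) (sumBy f xs) (sumBy g xs)
  where
  interchange : ∀ a b c d → a + b + (c + d) ≡ a + c + (b + d)
  interchange = solve-∀

sumBy-*ˡ : {A : Set} (c : ℕ) (f : A → ℕ) (xs : List A) → sumBy (λ x → c * f x) xs ≡ c * sumBy f xs
sumBy-*ˡ c f [] = sym (*-zeroʳ c)
sumBy-*ˡ c f (x ∷ xs) = trans (cong (c * f x +_) (sumBy-*ˡ c f xs)) (sym (*-distribˡ-+ c (f x) _))

sumBy-comm : {A B : Set} (g : A → B → ℕ) (xs : List A) (ys : List B) →
  sumBy (λ x → sumBy (λ y → g x y) ys) xs ≡ sumBy (λ y → sumBy (λ x → g x y) xs) ys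
sumBy-comm g [] ys = sym (sumBy-0 ys)
sumBy-comm g (x ∷ xs) ys =
  trans (cong (sumBy (g x) ys +_) (sumBy-comm g xs ys)) (sym (sumBy-+ (g x) _ ys))

sumBy-𝟙-* : {A : Set} (p : A → Bool) (c : ℕ) (xs : List A) →
  sumBy (λ x → 𝟙 (p x) * c) xs ≡ count p xs * c
sumBy-𝟙-* p c [] = refl
sumBy-𝟙-* p c (x ∷ xs) with p x
... | true = cong₂ _+_ (+-identityʳ c) (sumBy-𝟙-* p c xs)
... | false = sumBy-𝟙-* p c xs

count-map : {A B : Set} (p : B → Bool) (g : A → B) (xs : List A) →
  count p (map g xs) ≡ count (λ x → p (g x)) xs
count-map p g xs = begin
  count p (map g xs)                ≡⟨ count≡sumBy-𝟙 p (map g xs) ⟩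
  sumBy (λ y → 𝟙 (p y)) (map g xs)  ≡⟨ sumBy-map (λ y → 𝟙 (p y)) g xs ⟩
  sumBy (λ x → 𝟙 (p (g x))) xs      ≡⟨ count≡sumBy-𝟙 (λ x → p (g x)) xs ⟨
  count (λ x → p (g x)) xs          ∎
  where open ≡-Reasoning

count-concatMap : {A B : Set} (p : B → Bool) (g : A → List B) (xs : List A) →
  count p (concatMap g xs) ≡ sumBy (λ x → count p (g x)) xs
count-concatMap p g xs = begin
  count p (concatMap g xs)                       ≡⟨ count≡sumBy-𝟙 p (concatMap g xs) ⟩
  sumBy (λ y → 𝟙 (p y)) (concatMap g xs)         ≡⟨ sumBy-concatMap (λ y → 𝟙 (p y)) g xs ⟩
  sumBy (λ x → sumBy (λ y → 𝟙 (p y)) (g x)) xs  ≡⟨ sumBy-cong xs (λ x → count≡sumBy-𝟙 p (g x)) ⟨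
  sumBy (λ x → count p (g x)) xs                 ∎
  where open ≡-Reasoning

every : {A : Set} {k : ℕ} → (A → Bool) → Vec A k → Bool
every q [] = true
every q (x ∷ v) = q x ∧ every q v

every-true : {A : Set} {k : ℕ} (v : Vec A k) → every (λ _ → true) v ≡ true
every-true [] = refl
every-true (x ∷ v) = every-true v

count-every-allVecs : {A : Set} (q : A → Bool) (L : List A) (k : ℕ) →
  count (every q) (allVecs L k) ≡ count q L ^ k
count-every-allVecs q L zero = refl
count-every-allVecs q L (suc k) = begin
    count (every q) (concatMap (λ x → map (x ∷_) V) L)
  ≡⟨ count-concatMap (every q) (λ x → map (x ∷_) V) L ⟩
    sumBy (λ x → count (every q) (map (x ∷_) V)) L
  ≡⟨ sumBy-cong L (λ x → trans (count-map (every q) (x ∷_) V) (count-const-∧ (q x) (every q) V)) ⟩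
    sumBy (λ x → 𝟙 (q x) * count (every q) V) L
  ≡⟨ sumBy-𝟙-* q _ L ⟩
    count q L * count (every q) V
  ≡⟨ cong (count q L *_) (count-every-allVecs q L k) ⟩
    count q L * count q L ^ k ∎
  where
  open ≡-Reasoning
  V = allVecs L k

infix 4 _==_

_==_ : ∀ {n} → Fin n → Fin n → Bool
zero == zero = true
zero == suc _ = false
suc _ == zero = false
suc x == suc y = x == y

==-refl : ∀ {n} (x : Fin n) → (x == x) ≡ true
==-refl zero = refl
==-refl (suc x) = ==-refl x

==⇒≡ : ∀ {n} (x y : Fin n) → (x == y) ≡ true → x ≡ y
==⇒≡ zero zero e = refl
==⇒≡ (suc x) (suc y) e = cong suc (==⇒≡ x y e)

≢⇒==-false : ∀ {n} (x y : Fin n) → x ≢ y → (x == y) ≡ false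
≢⇒==-false x y x≢y with x == y in e
... | false = refl
... | true = ⊥-elim (x≢y (==⇒≡ x y e))

insert : ∀ {n} → Fin n → (Fin n → Bool) → Fin n → Bool
insert x U y = U y ∨ (y == x)

insert-self : ∀ {n} (U : Fin n → Bool) x → insert x U x ≡ true
insert-self U x rewrite ==-refl x = ∨-zeroʳ (U x)

not-∨ : ∀ u e → not (u ∨ e) ≡ not u ∧ not e
not-∨ true e = refl
not-∨ false e = refl

not-∨-∧ : ∀ u e t → not (u ∨ e) ∧ t ≡ (not u ∧ t) ∧ not e
not-∨-∧ true e t = refl
not-∨-∧ false true t = sym (∧-zeroʳ t)
not-∨-∧ false false t = sym (∧-identityʳ t)

countᶠ : ∀ {n} → (Fin n → Bool) → ℕ
countᶠ {zero} h = 0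
countᶠ {suc n} h = 𝟙 (h zero) + countᶠ (λ i → h (suc i))

sumᶠ : ∀ {n} → (Fin n → ℕ) → ℕ
sumᶠ {zero} h = 0
sumᶠ {suc n} h = h zero + sumᶠ (λ i → h (suc i))

sumBy-tabulate : ∀ {n} {A : Set} (f : A → ℕ) (g : Fin n → A) →
  sumBy f (tabulate g) ≡ sumᶠ (λ i → f (g i))
sumBy-tabulate {zero} f g = refl
sumBy-tabulate {suc n} f g = cong (f (g zero) +_) (sumBy-tabulate f (λ i → g (suc i)))

countᶠ-true : ∀ n → countᶠ {n} (λ _ → true) ≡ n
countᶠ-true zero = refl
countᶠ-true (suc n) = cong suc (countᶠ-true n)

countᶠ-lookup : ∀ {n} (T : Subset n) → countᶠ (lookup T) ≡ ∣ T ∣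
countᶠ-lookup [] = refl
countᶠ-lookup (true ∷ T) = cong suc (countᶠ-lookup T)
countᶠ-lookup (false ∷ T) = countᶠ-lookup T

countᶠ-cong : ∀ {n} {h h' : Fin n → Bool} → (∀ i → h i ≡ h' i) → countᶠ h ≡ countᶠ h'
countᶠ-cong {zero} e = refl
countᶠ-cong {suc n} e = cong₂ _+_ (cong 𝟙 (e zero)) (countᶠ-cong (λ i → e (suc i)))

countᶠ-mono : ∀ {n} (h h' : Fin n → Bool) → (∀ i → h i ≡ true → h' i ≡ true) → countᶠ h ≤ countᶠ h'
countᶠ-mono {zero} h h' e = z≤n
countᶠ-mono {suc n} h h' e = +-mono-≤ (𝟙-mono (h zero) (h' zero) (e zero)) (countᶠ-mono _ _ (λ i → e (suc i)))
  where
  𝟙-mono : ∀ a b → (a ≡ true → b ≡ true) → 𝟙 a ≤ 𝟙 b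
  𝟙-mono true b f rewrite f refl = s≤s z≤n
  𝟙-mono false b f = z≤n

𝟙-split : ∀ a b → 𝟙 a ≡ 𝟙 (a ∧ b) + 𝟙 (a ∧ not b)
𝟙-split true true = refl
𝟙-split true false = refl
𝟙-split false b = refl

countᶠ-split : ∀ {n} (h q : Fin n → Bool) →
  countᶠ h ≡ countᶠ (λ i → h i ∧ q i) + countᶠ (λ i → h i ∧ not (q i))
countᶠ-split {zero} h q = refl
countᶠ-split {suc n} h q
  rewrite countᶠ-split (λ i → h (suc i)) (λ i → q (suc i)) | 𝟙-split (h zero) (q zero) =
  interchange (𝟙 (h zero ∧ q zero)) (𝟙 (h zero ∧ not (q zero))) _ _
  where
  interchange : ∀ a b c d → a + b + (c + d) ≡ a + c + (b + d)
  interchange = solve-∀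

countᶠ-remove-member : ∀ {n} (h : Fin n → Bool) (x : Fin n) → h x ≡ true →
  countᶠ h ≡ suc (countᶠ (λ y → h y ∧ not (y == x)))
countᶠ-remove-member {suc n} h zero e rewrite e =
  cong suc (countᶠ-cong (λ i → sym (∧-identityʳ (h (suc i)))))
countᶠ-remove-member {suc n} h (suc x) e
  rewrite countᶠ-remove-member (λ i → h (suc i)) x e | ∧-identityʳ (h zero) = +-suc (𝟙 (h zero)) _

countᶠ-remove-nonmember : ∀ {n} (h : Fin n → Bool) (x : Fin n) → h x ≡ false →
  countᶠ h ≡ countᶠ (λ y → h y ∧ not (y == x))
countᶠ-remove-nonmember {suc n} h zero e rewrite e = countᶠ-cong (λ i → sym (∧-identityʳ (h (suc i))))
countᶠ-remove-nonmember {suc n} h (suc x) e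
  rewrite countᶠ-remove-nonmember (λ i → h (suc i)) x e | ∧-identityʳ (h zero) = refl

sumᶠ-two-valued : ∀ {n} (p q : Fin n → Bool) (f : Fin n → ℕ) (c₁ c₂ : ℕ) →
  (∀ x → p x ≡ true → q x ≡ true → f x ≡ c₁) →
  (∀ x → p x ≡ true → q x ≡ false → f x ≡ c₂) →
  (∀ x → p x ≡ false → f x ≡ 0) →
  sumᶠ f ≡ countᶠ (λ x → p x ∧ q x) * c₁ + countᶠ (λ x → p x ∧ not (q x)) * c₂
sumᶠ-two-valued {zero} p q f c₁ c₂ h₁ h₂ h₀ = refl
sumᶠ-two-valued {suc n} p q f c₁ c₂ h₁ h₂ h₀
  rewrite sumᶠ-two-valued (λ i → p (suc i)) (λ i → q (suc i)) (λ i → f (suc i)) c₁ c₂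
            (λ x → h₁ (suc x)) (λ x → h₂ (suc x)) (λ x → h₀ (suc x))
  with p zero | q zero | h₁ zero | h₂ zero | h₀ zero
... | true | true | e | _ | _ rewrite e refl refl = add-first c₁ c₂ (countᶠ (λ x → p (suc x) ∧ q (suc x))) (countᶠ (λ x → p (suc x) ∧ not (q (suc x))))
  where
  add-first : ∀ c₁ c₂ a b → c₁ + (a * c₁ + b * c₂) ≡ (1 + a) * c₁ + b * c₂
  add-first = solve-∀
... | true | false | _ | e | _ rewrite e refl refl = add-second c₁ c₂ (countᶠ (λ x → p (suc x) ∧ q (suc x))) (countᶠ (λ x → p (suc x) ∧ not (q (suc x))))
  where
  add-second : ∀ c₁ c₂ a b → c₂ + (a * c₁ + b * c₂) ≡ a * c₁ + (1 + b) * c₂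
  add-second = solve-∀
... | false | _ | _ | _ | e rewrite e refl = refl

falling : ℕ → ℕ → ℕ
falling g zero = 1
falling g (suc a) = g * falling (g ∸ 1) a

falling-suc : ∀ g a → falling g (suc a) ≡ falling g a * (g ∸ a)
falling-suc g zero = trans (*-identityʳ g) (sym (+-identityʳ g))
falling-suc g (suc a) = begin
    g * falling (g ∸ 1) (suc a)
  ≡⟨ cong (g *_) (falling-suc (g ∸ 1) a) ⟩
    g * (falling (g ∸ 1) a * (g ∸ 1 ∸ a))
  ≡⟨ sym (*-assoc g _ _) ⟩
    g * falling (g ∸ 1) a * (g ∸ 1 ∸ a)
  ≡⟨ cong (g * falling (g ∸ 1) a *_) (∸-+-assoc g 1 a) ⟩
    g * falling (g ∸ 1) a * (g ∸ suc a) ∎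
  where open ≡-Reasoning

falling-vanishes : ∀ g a → g < a → falling g a ≡ 0
falling-vanishes zero (suc a) _ = refl
falling-vanishes (suc g) (suc a) (s≤s lt) =
  trans (cong (suc g *_) (falling-vanishes g a lt)) (*-zeroʳ (suc g))

falling-self : ∀ n → falling n n ≡ n !
falling-self zero = refl
falling-self (suc n) = cong (suc n *_) (falling-self n)

trues : ∀ {k} → Vec Bool k → ℕ
trues [] = 0
trues (true ∷ c) = suc (trues c)
trues (false ∷ c) = trues c

falses : ∀ {k} → Vec Bool k → ℕ
falses [] = 0
falses (true ∷ c) = falses c
falses (false ∷ c) = suc (falses c)

unused : ∀ {n} → (Fin n → Bool) → ℕ
unused U = countᶠ (λ x → not (U x))

unusedIn : ∀ {n} → (Fin n → Bool) → (Fin n → Bool) → ℕ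
unusedIn T U = countᶠ (λ x → not (U x) ∧ T x)

unused-insert : ∀ {n} (U : Fin n → Bool) x → U x ≡ false → unused U ≡ suc (unused (insert x U))
unused-insert U x e = trans (countᶠ-remove-member (λ y → not (U y)) x (cong not e))
  (cong suc (countᶠ-cong (λ y → sym (not-∨ (U y) (y == x)))))

unusedIn-insert-member : ∀ {n} (T U : Fin n → Bool) x → U x ≡ false → T x ≡ true →
  unusedIn T U ≡ suc (unusedIn T (insert x U))
unusedIn-insert-member T U x e t =
  trans (countᶠ-remove-member (λ y → not (U y) ∧ T y) x (cong₂ _∧_ (cong not e) t))
        (cong suc (countᶠ-cong (λ y → sym (not-∨-∧ (U y) (y == x) (T y)))))

unusedIn-insert-nonmember : ∀ {n} (T U : Fin n → Bool) x → T x ≡ false →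
  unusedIn T U ≡ unusedIn T (insert x U)
unusedIn-insert-nonmember T U x t =
  trans (countᶠ-remove-nonmember (λ y → not (U y) ∧ T y) x (trans (cong (not (U x) ∧_) t) (∧-zeroʳ _)))
        (countᶠ-cong (λ y → sym (not-∨-∧ (U y) (y == x) (T y))))

unusedIn≤unused : ∀ {n} (T U : Fin n → Bool) → unusedIn T U ≤ unused U
unusedIn≤unused T U = countᶠ-mono _ _ (λ i → ∧-elimˡ {not (U i)} {T i})

unused-outside : ∀ {n} (T U : Fin n → Bool) →
  countᶠ (λ x → not (U x) ∧ not (T x)) ≡ unused U ∸ unusedIn T U
unused-outside T U =
  sym (trans (cong (_∸ unusedIn T U) (countᶠ-split (λ x → not (U x)) T)) (m+n∸m≡n (unusedIn T U) _))

-- U records the values already taken by earlier entries, which is how injectivity is enforced.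
Admissible : ∀ {n k} → (Fin n → Bool) → (Fin n → Bool) → Vec Bool k → Vec (Fin n) k → Bool
Admissible T U [] [] = true
Admissible T U (c ∷ cs) (x ∷ v) = not (U x) ∧ ((not c ∨ T x) ∧ Admissible T (insert x U) cs v)

admissibleHeads : ∀ {n} k (T U : Fin n → Bool) (b : Bool) (cs : Vec Bool k) → Fin n → ℕ
admissibleHeads {n} k T U b cs x =
  𝟙 (not (U x)) * (𝟙 (not b ∨ T x) * count (Admissible T (insert x U) cs) (allVecs (allFin n) k))

count-admissible-cons : ∀ {n} k (T U : Fin n → Bool) (b : Bool) (cs : Vec Bool k) →
  count (Admissible T U (b ∷ cs)) (allVecs (allFin n) (suc k)) ≡ sumᶠ (admissibleHeads k T U b cs)
count-admissible-cons {n} k T U b cs = begin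
    count (Admissible T U (b ∷ cs)) (concatMap (λ x → map (x ∷_) V) L)
  ≡⟨ count-concatMap (Admissible T U (b ∷ cs)) (λ x → map (x ∷_) V) L ⟩
    sumBy (λ x → count (Admissible T U (b ∷ cs)) (map (x ∷_) V)) L
  ≡⟨ sumBy-cong L (λ x → trans (count-map (Admissible T U (b ∷ cs)) (x ∷_) V)
       (trans (count-const-∧ (not (U x)) (λ v → (not b ∨ T x) ∧ Admissible T (insert x U) cs v) V)
         (cong (𝟙 (not (U x)) *_) (count-const-∧ (not b ∨ T x) (Admissible T (insert x U) cs) V)))) ⟩
    sumBy (admissibleHeads k T U b cs) L
  ≡⟨ sumBy-tabulate (admissibleHeads k T U b cs) (λ i → i) ⟩
    sumᶠ (admissibleHeads k T U b cs) ∎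
  where
  open ≡-Reasoning
  L = allFin n
  V = allVecs L k

module CountAdmissibleCons {n} k (T U : Fin n → Bool) (cs : Vec Bool k)
  (count-tail : ∀ U' → count (Admissible T U' cs) (allVecs (allFin n) k)
                         ≡ falling (unusedIn T U') (trues cs) * falling (unused U' ∸ trues cs) (falses cs))
  where

  private
    V = allVecs (allFin n) k
    G = unusedIn T U
    F = unused U
    a = trues cs
    r = falses cs
    X = falling (F ∸ 1 ∸ a) r

    1*1*m≡m : ∀ m → 1 * (1 * m) ≡ m
    1*1*m≡m m = trans (+-identityʳ _) (+-identityʳ m)

    unused-after : ∀ x → U x ≡ false → unused (insert x U) ≡ F ∸ 1
    unused-after x e = sym (cong (_∸ 1) (unused-insert U x e))

    tail-member : ∀ x → U x ≡ false → T x ≡ true →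
      count (Admissible T (insert x U) cs) V ≡ falling (G ∸ 1) a * X
    tail-member x e t = trans (count-tail (insert x U)) (cong₂ (λ g f → falling g a * falling (f ∸ a) r)
      (sym (cong (_∸ 1) (unusedIn-insert-member T U x e t))) (unused-after x e))

    tail-nonmember : ∀ x → U x ≡ false → T x ≡ false →
      count (Admissible T (insert x U) cs) V ≡ falling G a * X
    tail-nonmember x e t = trans (count-tail (insert x U)) (cong₂ (λ g f → falling g a * falling (f ∸ a) r)
      (sym (unusedIn-insert-nonmember T U x t)) (unused-after x e))

  count-cons-true : sumᶠ (admissibleHeads k T U true cs) ≡ falling G (suc a) * falling (F ∸ suc a) r
  count-cons-true = begin
      sumᶠ (admissibleHeads k T U true cs)
    ≡⟨ sumᶠ-two-valued (λ x → not (U x)) T (admissibleHeads k T U true cs) (falling (G ∸ 1) a * X) 0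
         (λ x p q → trans (cong₂ (λ u t → 𝟙 u * (𝟙 t * count (Admissible T (insert x U) cs) V)) p q)
                      (trans (1*1*m≡m _) (tail-member x (not-injective p) q)))
         (λ x p q → cong₂ (λ u t → 𝟙 u * (𝟙 t * count (Admissible T (insert x U) cs) V)) p q)
         (λ x p → cong (λ u → 𝟙 u * (𝟙 (T x) * count (Admissible T (insert x U) cs) V)) p) ⟩
      G * (falling (G ∸ 1) a * X) + countᶠ (λ x → not (U x) ∧ not (T x)) * 0
    ≡⟨ trans (cong (G * (falling (G ∸ 1) a * X) +_) (*-zeroʳ (countᶠ (λ x → not (U x) ∧ not (T x))))) (+-identityʳ _) ⟩
      G * (falling (G ∸ 1) a * X)
    ≡⟨ sym (*-assoc G _ _) ⟩
      G * falling (G ∸ 1) a * falling (F ∸ 1 ∸ a) r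
    ≡⟨ cong (λ z → G * falling (G ∸ 1) a * falling z r) (∸-+-assoc F 1 a) ⟩
      falling G (suc a) * falling (F ∸ suc a) r ∎
    where open ≡-Reasoning

  count-cons-false : sumᶠ (admissibleHeads k T U false cs) ≡ falling G a * falling (F ∸ a) (suc r)
  count-cons-false = begin
      sumᶠ (admissibleHeads k T U false cs)
    ≡⟨ sumᶠ-two-valued (λ x → not (U x)) T (admissibleHeads k T U false cs) (falling (G ∸ 1) a * X) (falling G a * X)
         (λ x p q → trans (cong (λ u → 𝟙 u * (1 * count (Admissible T (insert x U) cs) V)) p)
                      (trans (1*1*m≡m _) (tail-member x (not-injective p) q)))
         (λ x p q → trans (cong (λ u → 𝟙 u * (1 * count (Admissible T (insert x U) cs) V)) p)
                      (trans (1*1*m≡m _) (tail-nonmember x (not-injective p) q)))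
         (λ x p → cong (λ u → 𝟙 u * (1 * count (Admissible T (insert x U) cs) V)) p) ⟩
      G * (falling (G ∸ 1) a * X) + countᶠ (λ x → not (U x) ∧ not (T x)) * (falling G a * X)
    ≡⟨ cong (λ z → G * (falling (G ∸ 1) a * X) + z * (falling G a * X)) (unused-outside T U) ⟩
      G * (falling (G ∸ 1) a * X) + (F ∸ G) * (falling G a * X)
    ≡⟨ cong (_+ (F ∸ G) * (falling G a * X)) (sym (*-assoc G _ X)) ⟩
      falling G (suc a) * X + (F ∸ G) * (falling G a * X)
    ≡⟨ cong (λ z → z * X + (F ∸ G) * (falling G a * X)) (falling-suc G a) ⟩
      falling G a * (G ∸ a) * X + (F ∸ G) * (falling G a * X)
    ≡⟨ factor (falling G a) (G ∸ a) (F ∸ G) X ⟩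
      falling G a * ((G ∸ a + (F ∸ G)) * X)
    ≡⟨ merge ⟩
      falling G a * ((F ∸ a) * falling (F ∸ a ∸ 1) r) ∎
    where
    open ≡-Reasoning
    factor : ∀ p q d x → p * q * x + d * (p * x) ≡ p * ((q + d) * x)
    factor = solve-∀
    X≡ : X ≡ falling (F ∸ a ∸ 1) r
    X≡ = cong (λ z → falling z r) (trans (∸-+-assoc F 1 a) (trans (cong (F ∸_) (+-comm 1 a)) (sym (∸-+-assoc F a 1))))
    merge : falling G a * ((G ∸ a + (F ∸ G)) * X) ≡ falling G a * ((F ∸ a) * falling (F ∸ a ∸ 1) r)
    merge with a ≤? G
    ... | yes a≤G = cong₂ (λ u v → falling G a * (u * v)) telescope X≡
      where
      telescope : G ∸ a + (F ∸ G) ≡ F ∸ a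
      telescope = trans (+-comm (G ∸ a) (F ∸ G))
        (trans (sym (+-∸-assoc (F ∸ G) a≤G)) (cong (_∸ a) (m∸n+n≡m (unusedIn≤unused T U))))
    ... | no a≰G rewrite falling-vanishes G a (≰⇒> a≰G) = refl

count-admissible : ∀ {n} k (T U : Fin n → Bool) (c : Vec Bool k) →
  count (Admissible T U c) (allVecs (allFin n) k)
    ≡ falling (unusedIn T U) (trues c) * falling (unused U ∸ trues c) (falses c)
count-admissible zero T U [] = refl
count-admissible (suc k) T U (true ∷ cs) = trans (count-admissible-cons k T U true cs)
  (CountAdmissibleCons.count-cons-true k T U cs (λ U' → count-admissible k T U' cs))
count-admissible (suc k) T U (false ∷ cs) = trans (count-admissible-cons k T U false cs)
  (CountAdmissibleCons.count-cons-false k T U cs (λ U' → count-admissible k T U' cs))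

all-tabulate⁻ : ∀ {n} {A : Set} (p : A → Bool) (g : Fin n → A) →
  all p (tabulate g) ≡ true → ∀ i → p (g i) ≡ true
all-tabulate⁻ p g e zero = ∧-elimˡ e
all-tabulate⁻ p g e (suc i) = all-tabulate⁻ p (λ j → g (suc j)) (∧-elimʳ {p (g zero)} e) i

all-tabulate⁺ : ∀ {n} {A : Set} (p : A → Bool) (g : Fin n → A) →
  (∀ i → p (g i) ≡ true) → all p (tabulate g) ≡ true
all-tabulate⁺ {zero} p g h = refl
all-tabulate⁺ {suc n} p g h = ∧-intro (h zero) (all-tabulate⁺ p (λ j → g (suc j)) (λ i → h (suc i)))

all-false⇒counterexample : ∀ {A : Set} (p : A → Bool) (xs : List A) → all p xs ≡ false → ∃ λ x → p x ≡ false
all-false⇒counterexample p (x ∷ xs) e with p x in px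
... | true = all-false⇒counterexample p xs e
... | false = x , px

any-tabulate⁺ : ∀ {n} {A : Set} (p : A → Bool) (g : Fin n → A) (i : Fin n) →
  p (g i) ≡ true → any p (tabulate g) ≡ true
any-tabulate⁺ p g zero e rewrite e = refl
any-tabulate⁺ p g (suc i) e with p (g zero)
... | true = refl
... | false = any-tabulate⁺ p (λ j → g (suc j)) i e

any-tabulate-false : ∀ {n} {A : Set} (p : A → Bool) (g : Fin n → A) →
  any p (tabulate g) ≡ false → ∀ i → p (g i) ≡ false
any-tabulate-false p g e zero with p (g zero)
... | false = refl
any-tabulate-false p g e (suc i) with p (g zero)
... | false = any-tabulate-false p (λ j → g (suc j)) e i

Distinct : ∀ {n k} → Vec (Fin n) k → Set
Distinct v = ∀ i j → lookup v i ≡ lookup v j → i ≡ j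

injectiveᵇ-sound : ∀ {n} (σ : Vec (Fin n) n) → injectiveᵇ σ ≡ true → Distinct σ
injectiveᵇ-sound σ e i j eq = pair-sound (all-tabulate⁻ _ (λ j → j) (all-tabulate⁻ _ (λ i → i) e i) j)
  where
  pair-sound : (not ⌊ lookup σ i ≟ lookup σ j ⌋ ∨ ⌊ i ≟ j ⌋) ≡ true → i ≡ j
  pair-sound h with lookup σ i ≟ lookup σ j | i ≟ j
  ... | _ | yes i≡j = i≡j
  ... | yes _ | no _ with () ← h
  ... | no σi≢σj | no _ = ⊥-elim (σi≢σj eq)

injectiveᵇ-complete : ∀ {n} (σ : Vec (Fin n) n) → Distinct σ → injectiveᵇ σ ≡ true
injectiveᵇ-complete σ h = all-tabulate⁺ _ (λ i → i) (λ i → all-tabulate⁺ _ (λ j → j) (pair-complete i))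
  where
  pair-complete : ∀ i j → (not ⌊ lookup σ i ≟ lookup σ j ⌋ ∨ ⌊ i ≟ j ⌋) ≡ true
  pair-complete i j with lookup σ i ≟ lookup σ j | i ≟ j
  ... | _ | yes _ = ∨-zeroʳ _
  ... | yes eq | no i≢j = ⊥-elim (i≢j (h i j eq))
  ... | no _ | no _ = refl

admissible-sound : ∀ {n k} (T U : Fin n → Bool) (c : Vec Bool k) (v : Vec (Fin n) k) →
  Admissible T U c v ≡ true →
  Distinct v × (∀ i → U (lookup v i) ≡ false) × (∀ i → lookup c i ≡ true → T (lookup v i) ≡ true)
admissible-sound T U [] [] e = (λ ()) , (λ ()) , (λ ())
admissible-sound T U (b ∷ c) (x ∷ v) e = distinct , avoids , respects
  where
  head-unused : U x ≡ false
  head-unused = not-injective (∧-elimˡ e)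
  head-respects : (not b ∨ T x) ≡ true
  head-respects = ∧-elimˡ (∧-elimʳ {not (U x)} e)
  tail = admissible-sound T (insert x U) c v (∧-elimʳ {not b ∨ T x} (∧-elimʳ {not (U x)} e))
  tail-avoids-head : ∀ i → lookup v i ≢ x
  tail-avoids-head i eq with () ← trans (sym (proj₁ (proj₂ tail) i)) (trans (cong (insert x U) eq) (insert-self U x))
  distinct : Distinct (x ∷ v)
  distinct zero zero _ = refl
  distinct zero (suc j) eq = ⊥-elim (tail-avoids-head j (sym eq))
  distinct (suc i) zero eq = ⊥-elim (tail-avoids-head i eq)
  distinct (suc i) (suc j) eq = cong suc (proj₁ tail i j eq)
  avoids : ∀ i → U (lookup (x ∷ v) i) ≡ false
  avoids zero = head-unused
  avoids (suc i) = ∨-false-elimˡ (proj₁ (proj₂ tail) i)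
    where
    ∨-false-elimˡ : ∀ {a b} → a ∨ b ≡ false → a ≡ false
    ∨-false-elimˡ {false} _ = refl
  respects : ∀ i → lookup (b ∷ c) i ≡ true → T (lookup (x ∷ v) i) ≡ true
  respects zero refl = head-respects
  respects (suc i) bt = proj₂ (proj₂ tail) i bt

admissible-complete : ∀ {n k} (T U : Fin n → Bool) (c : Vec Bool k) (v : Vec (Fin n) k) →
  Distinct v → (∀ i → U (lookup v i) ≡ false) → (∀ i → lookup c i ≡ true → T (lookup v i) ≡ true) →
  Admissible T U c v ≡ true
admissible-complete T U [] [] _ _ _ = refl
admissible-complete T U (b ∷ c) (x ∷ v) distinct avoids respects =
  ∧-intro (cong not (avoids zero)) (∧-intro head-respects tail)
  where
  head-respects : (not b ∨ T x) ≡ true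
  head-respects = implication b (respects zero)
    where
    implication : ∀ b → (b ≡ true → T x ≡ true) → (not b ∨ T x) ≡ true
    implication true r = r refl
    implication false _ = refl
  tail-avoids : ∀ i → insert x U (lookup v i) ≡ false
  tail-avoids i rewrite avoids (suc i) = ≢⇒==-false (lookup v i) x (λ eq → case distinct (suc i) zero eq of λ ())
  tail : Admissible T (insert x U) c v ≡ true
  tail = admissible-complete T (insert x U) c v
    (λ i j eq → Finₚ.suc-injective (distinct (suc i) (suc j) eq)) tail-avoids (λ i → respects (suc i))

MapsInto : ∀ {n} → Subset n → Subset n → Vec (Fin n) n → Bool
MapsInto A T σ = allF (λ x → not (lookup A x) ∨ lookup T (lookup σ x))

mapsInto-sound : ∀ {n} (A T : Subset n) σ → MapsInto A T σ ≡ true →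
  ∀ x → lookup A x ≡ true → lookup T (lookup σ x) ≡ true
mapsInto-sound A T σ e x ax with all-tabulate⁻ _ (λ i → i) e x
... | h rewrite ax = h

mapsInto-complete : ∀ {n} (A T : Subset n) σ →
  (∀ x → lookup A x ≡ true → lookup T (lookup σ x) ≡ true) → MapsInto A T σ ≡ true
mapsInto-complete A T σ h = all-tabulate⁺ _ (λ i → i) pointwise
  where
  pointwise : ∀ x → (not (lookup A x) ∨ lookup T (lookup σ x)) ≡ true
  pointwise x with lookup A x | h x
  ... | true | f = f refl
  ... | false | _ = refl

trues≡∣∣ : ∀ {n} (A : Subset n) → trues A ≡ ∣ A ∣
trues≡∣∣ [] = refl
trues≡∣∣ (true ∷ A) = cong suc (trues≡∣∣ A)
trues≡∣∣ (false ∷ A) = trues≡∣∣ A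

trues+falses : ∀ {n} (A : Vec Bool n) → trues A + falses A ≡ n
trues+falses [] = refl
trues+falses (true ∷ A) = cong suc (trues+falses A)
trues+falses (false ∷ A) = trans (+-suc (trues A) (falses A)) (cong suc (trues+falses A))

falses≡n∸∣∣ : ∀ {n} (A : Subset n) → falses A ≡ n ∸ ∣ A ∣
falses≡n∸∣∣ {n} A = trans (sym (m+n∸m≡n (trues A) (falses A))) (cong₂ _∸_ (trues+falses A) (trues≡∣∣ A))

-- With nothing used and constraint vector A, a permutation is admissible iff it maps A into T.
count-perfectMatchings-mapsInto : ∀ {n} (A T : Subset n) →
  count (MapsInto A T) (perfectMatchings n) ≤ falling ∣ T ∣ ∣ A ∣ * ((n ∸ ∣ A ∣) !)
count-perfectMatchings-mapsInto {n} A T = begin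
    count (MapsInto A T) (perfectMatchings n)
  ≡⟨ count-filterᵇ injectiveᵇ (MapsInto A T) σs ⟩
    count (λ σ → injectiveᵇ σ ∧ MapsInto A T σ) σs
  ≤⟨ count-mono _ (Admissible (lookup T) (λ _ → false) A) σs admissible ⟩
    count (Admissible (lookup T) (λ _ → false) A) σs
  ≡⟨ count-admissible n (lookup T) (λ _ → false) A ⟩
    falling (countᶠ (lookup T)) (trues A) * falling (countᶠ {n} (λ _ → true) ∸ trues A) (falses A)
  ≡⟨ cong₂ _*_ (cong₂ falling (countᶠ-lookup T) (trues≡∣∣ A))
               (cong₂ falling (cong₂ _∸_ (countᶠ-true n) (trues≡∣∣ A)) (falses≡n∸∣∣ A)) ⟩
    falling (∣ T ∣) (∣ A ∣) * falling (n ∸ ∣ A ∣) (n ∸ ∣ A ∣)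
  ≡⟨ cong (falling (∣ T ∣) (∣ A ∣) *_) (falling-self (n ∸ ∣ A ∣)) ⟩
    falling (∣ T ∣) (∣ A ∣) * ((n ∸ ∣ A ∣) !) ∎
  where
  open ≤-Reasoning
  σs = allVecs (allFin n) n
  admissible : ∀ σ → (injectiveᵇ σ ∧ MapsInto A T σ) ≡ true → Admissible (lookup T) (λ _ → false) A σ ≡ true
  admissible σ e = admissible-complete (lookup T) (λ _ → false) A σ
    (injectiveᵇ-sound σ (∧-elimˡ e)) (λ _ → refl) (mapsInto-sound A T σ (∧-elimʳ {injectiveᵇ σ} e))

length-perfectMatchings : ∀ n → length (perfectMatchings n) ≡ n !
length-perfectMatchings n = begin
    length (perfectMatchings n)
  ≡⟨ length-filterᵇ injectiveᵇ σs ⟩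
    count injectiveᵇ σs
  ≡⟨ count-cong _ _ σs injective≡admissible ⟩
    count (Admissible (λ _ → true) (λ _ → false) none) σs
  ≡⟨ count-admissible n (λ _ → true) (λ _ → false) none ⟩
    falling (countᶠ {n} (λ _ → true)) (trues none) * falling (countᶠ {n} (λ _ → true) ∸ trues none) (falses none)
  ≡⟨ cong₂ _*_ (cong (falling _) (trues-none n))
               (cong₂ falling (cong₂ _∸_ (countᶠ-true n) (trues-none n)) (falses-none n)) ⟩
    1 * falling n n
  ≡⟨ trans (+-identityʳ _) (falling-self n) ⟩
    n ! ∎
  where
  open ≡-Reasoning
  σs = allVecs (allFin n) n
  none = replicate n false
  trues-none : ∀ n → trues (replicate n false) ≡ 0
  trues-none zero = refl
  trues-none (suc n) = trues-none n
  falses-none : ∀ n → falses (replicate n false) ≡ n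
  falses-none zero = refl
  falses-none (suc n) = cong suc (falses-none n)
  injective≡admissible : ∀ σ → injectiveᵇ σ ≡ Admissible (λ _ → true) (λ _ → false) none σ
  injective≡admissible σ with injectiveᵇ σ in e | Admissible (λ _ → true) (λ _ → false) none σ in e'
  ... | true | true = refl
  ... | false | false = refl
  ... | true | false with () ← trans (sym (admissible-complete (λ _ → true) (λ _ → false) none σ
                                         (injectiveᵇ-sound σ e) (λ _ → refl) (λ _ _ → refl))) e'
  ... | false | true with () ← trans (sym (injectiveᵇ-complete σ
                                         (proj₁ (admissible-sound (λ _ → true) (λ _ → false) none σ e')))) e

true⇒T : ∀ {b} → b ≡ true → T b
true⇒T refl = tt

T⇒true : ∀ b → T b → b ≡ true
T⇒true true _ = refl

≡ᵇ-true⇒≡ : ∀ m n → (m ≡ᵇ n) ≡ true → m ≡ n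
≡ᵇ-true⇒≡ m n e = ≡ᵇ⇒≡ m n (true⇒T e)

≡ᵇ-refl : ∀ m → (m ≡ᵇ m) ≡ true
≡ᵇ-refl m = T⇒true _ (≡⇒≡ᵇ m m refl)

≤ᵇ-true⇒≤ : ∀ m n → (m ≤ᵇ n) ≡ true → m ≤ n
≤ᵇ-true⇒≤ m n e = ≤ᵇ⇒≤ m n (true⇒T e)

≤⇒≤ᵇ-true : ∀ m n → m ≤ n → (m ≤ᵇ n) ≡ true
≤⇒≤ᵇ-true m n m≤n = T⇒true _ (≤⇒≤ᵇ m≤n)

≤ᵇ-false⇒> : ∀ m n → (m ≤ᵇ n) ≡ false → n < m
≤ᵇ-false⇒> m n e = ≰⇒> (λ m≤n → case trans (sym (≤⇒≤ᵇ-true m n m≤n)) e of λ ())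

choose : ℕ → ℕ → ℕ
choose n zero = 1
choose zero (suc k) = 0
choose (suc n) (suc k) = choose n k + choose n (suc k)

count-subsets-of-size : ∀ n s → count (λ A → ∣ A ∣ ≡ᵇ s) (allSubsets n) ≡ choose n s
count-subsets-of-size zero zero = refl
count-subsets-of-size zero (suc s) = refl
count-subsets-of-size (suc n) s = begin
    count (λ A → ∣ A ∣ ≡ᵇ s) (allSubsets (suc n))
  ≡⟨ count-concatMap (λ A → ∣ A ∣ ≡ᵇ s) (λ x → map (x ∷_) V) (true ∷ false ∷ []) ⟩
    count (λ A → ∣ A ∣ ≡ᵇ s) (map (true ∷_) V) + (count (λ A → ∣ A ∣ ≡ᵇ s) (map (false ∷_) V) + 0)
  ≡⟨ cong₂ _+_ (count-map (λ A → ∣ A ∣ ≡ᵇ s) (true ∷_) V)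
               (trans (+-identityʳ _) (count-map (λ A → ∣ A ∣ ≡ᵇ s) (false ∷_) V)) ⟩
    count (λ A → suc ∣ A ∣ ≡ᵇ s) V + count (λ A → ∣ A ∣ ≡ᵇ s) V
  ≡⟨ pascal s ⟩
    choose (suc n) s ∎
  where
  open ≡-Reasoning
  V = allSubsets n
  count-false : ∀ {A : Set} (xs : List A) → count (λ _ → false) xs ≡ 0
  count-false [] = refl
  count-false (x ∷ xs) = count-false xs
  pascal : ∀ s → count (λ A → suc ∣ A ∣ ≡ᵇ s) V + count (λ A → ∣ A ∣ ≡ᵇ s) V ≡ choose (suc n) s
  pascal zero = trans (cong (_+ count (λ A → ∣ A ∣ ≡ᵇ 0) V) (count-false V)) (count-subsets-of-size n zero)
  pascal (suc s) = cong₂ _+_ (count-subsets-of-size n s) (count-subsets-of-size n (suc s))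

≤-sumBy-allSubsets : ∀ {k} (g : Subset k → ℕ) (v : Subset k) → g v ≤ sumBy g (allSubsets k)
≤-sumBy-allSubsets g [] = m≤m+n (g []) 0
≤-sumBy-allSubsets {suc k} g (true ∷ v) = begin
    g (true ∷ v)
  ≤⟨ ≤-sumBy-allSubsets (λ w → g (true ∷ w)) v ⟩
    sumBy (λ w → g (true ∷ w)) V
  ≡⟨ sumBy-map g (true ∷_) V ⟨
    sumBy g (map (true ∷_) V)
  ≤⟨ m≤m+n _ _ ⟩
    sumBy g (map (true ∷_) V) + sumBy g (map (false ∷_) V ++ [])
  ≡⟨ sumBy-++ g (map (true ∷_) V) _ ⟨
    sumBy g (allSubsets (suc k)) ∎
  where
  open ≤-Reasoning
  V = allSubsets k
≤-sumBy-allSubsets {suc k} g (false ∷ v) = begin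
    g (false ∷ v)
  ≤⟨ ≤-sumBy-allSubsets (λ w → g (false ∷ w)) v ⟩
    sumBy (λ w → g (false ∷ w)) V
  ≡⟨ trans (+-identityʳ _) (sumBy-map g (false ∷_) V) ⟨
    sumBy g (map (false ∷_) V) + 0
  ≡⟨ sumBy-++ g (map (false ∷_) V) [] ⟨
    sumBy g (map (false ∷_) V ++ [])
  ≤⟨ m≤n+m _ _ ⟩
    sumBy g (map (true ∷_) V) + sumBy g (map (false ∷_) V ++ [])
  ≡⟨ sumBy-++ g (map (true ∷_) V) _ ⟨
    sumBy g (allSubsets (suc k)) ∎
  where
  open ≤-Reasoning
  V = allSubsets k

sumBelow : (ℕ → ℕ) → ℕ → ℕ
sumBelow f zero = 0
sumBelow f (suc L) = sumBelow f L + f L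

sumBelow-≥ : ∀ f L s → s < L → f s ≤ sumBelow f L
sumBelow-≥ f (suc L) s (s≤s s≤L) with m≤n⇒m<n∨m≡n s≤L
... | inj₁ s<L = ≤-trans (sumBelow-≥ f L s s<L) (m≤m+n _ _)
... | inj₂ refl = m≤n+m _ _

sumBelow-cong : ∀ f g L → (∀ s → f s ≡ g s) → sumBelow f L ≡ sumBelow g L
sumBelow-cong f g zero e = refl
sumBelow-cong f g (suc L) e = cong₂ _+_ (sumBelow-cong f g L e) (e L)

sumBelow-mono-≤ : ∀ f g L → (∀ s → f s ≤ g s) → sumBelow f L ≤ sumBelow g L
sumBelow-mono-≤ f g zero e = z≤n
sumBelow-mono-≤ f g (suc L) e = +-mono-≤ (sumBelow-mono-≤ f g L e) (e L)

sumBelow-*ʳ : ∀ f c L → sumBelow f L * c ≡ sumBelow (λ s → f s * c) L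
sumBelow-*ʳ f c zero = refl
sumBelow-*ʳ f c (suc L) = trans (*-distribʳ-+ c (sumBelow f L) (f L)) (cong (_+ f L * c) (sumBelow-*ʳ f c L))

sumBy-sumBelow : ∀ {A : Set} (g : ℕ → A → ℕ) (xs : List A) L →
  sumBy (λ x → sumBelow (λ s → g s x) L) xs ≡ sumBelow (λ s → sumBy (g s) xs) L
sumBy-sumBelow g xs zero = sumBy-0 xs
sumBy-sumBelow g xs (suc L) =
  trans (sumBy-+ (λ x → sumBelow (λ s → g s x) L) (g L) xs) (cong (_+ sumBy (g L) xs) (sumBy-sumBelow g xs L))

lookup-∁ : ∀ {n} (p : Subset n) i → lookup (∁ p) i ≡ not (lookup p i)
lookup-∁ (x ∷ p) zero = refl
lookup-∁ (x ∷ p) (suc i) = lookup-∁ p i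

subset-of-size : ∀ {n} (A : Subset n) r → r ≤ ∣ A ∣ →
  ∃ λ A' → (∀ i → lookup A' i ≡ true → lookup A i ≡ true) × ∣ A' ∣ ≡ r
subset-of-size {n} A zero _ = replicate n false , (λ i e → ⊥-elim (empty i e)) , ∣⊥∣≡0 n
  where
  empty : ∀ {n} (i : Fin n) → lookup (replicate n false) i ≢ true
  empty zero ()
  empty (suc i) e = empty i e
subset-of-size (true ∷ A) (suc r) (s≤s r≤∣A∣) with subset-of-size A r r≤∣A∣
... | A' , A'⊆A , ∣A'∣≡r = (true ∷ A') , (λ { zero _ → refl ; (suc i) e → A'⊆A i e }) , cong suc ∣A'∣≡r
subset-of-size (false ∷ A) (suc r) r<∣A∣ with subset-of-size A (suc r) r<∣A∣
... | A' , A'⊆A , ∣A'∣≡r = (false ∷ A') , (λ { zero () ; (suc i) e → A'⊆A i e }) , ∣A'∣≡r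

superset-of-size : ∀ {n} (T : Subset n) r → ∣ T ∣ ≤ r → r ≤ n →
  ∃ λ T' → (∀ i → lookup T i ≡ true → lookup T' i ≡ true) × ∣ T' ∣ ≡ r
superset-of-size {n} T r ∣T∣≤r r≤n
  with subset-of-size (∁ T) (n ∸ r) (subst (n ∸ r ≤_) (sym (∣∁p∣≡n∸∣p∣ T)) (∸-monoʳ-≤ n ∣T∣≤r))
... | A , A⊆∁T , ∣A∣≡n∸r = ∁ A , T⊆∁A , ∣∁A∣≡r
  where
  T⊆∁A : ∀ i → lookup T i ≡ true → lookup (∁ A) i ≡ true
  T⊆∁A i e with lookup A i in e'
  ... | false = trans (lookup-∁ A i) (cong not e')
  ... | true with () ← trans (sym (A⊆∁T i e')) (trans (lookup-∁ T i) (cong not e))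
  ∣∁A∣≡r : ∣ ∁ A ∣ ≡ r
  ∣∁A∣≡r = trans (∣∁p∣≡n∸∣p∣ A) (trans (cong (n ∸_) ∣A∣≡n∸r) (m∸[m∸n]≡n r≤n))

ceil/5 : ∀ n → ∃ λ m → n ≤ 5 * m × 5 * m ≤ n + 4
ceil/5 zero = 0 , z≤n , z≤n
ceil/5 (suc n) with ceil/5 n
... | m , n≤5m , 5m≤n+4 with m≤n⇒m<n∨m≡n n≤5m
... | inj₁ n<5m = m , n<5m , ≤-trans 5m≤n+4 (+-monoˡ-≤ 4 (n≤1+n n))
... | inj₂ refl = suc m , next-above m , next-below m
  where
  next-above : ∀ m → suc (5 * m) ≤ 5 * suc m
  next-above m rewrite *-suc 5 m = s≤s (m≤n+m (5 * m) 4)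
  next-below : ∀ m → 5 * suc m ≤ suc (5 * m) + 4
  next-below m rewrite *-suc 5 m | +-comm (5 * m) 4 = ≤-refl

⌈_/5⌉ : ℕ → ℕ
⌈ n /5⌉ = proj₁ (ceil/5 n)

n≤5*⌈n/5⌉ : ∀ n → n ≤ 5 * ⌈ n /5⌉
n≤5*⌈n/5⌉ n = proj₁ (proj₂ (ceil/5 n))

5*⌈n/5⌉≤n+4 : ∀ n → 5 * ⌈ n /5⌉ ≤ n + 4
5*⌈n/5⌉≤n+4 n = proj₂ (proj₂ (ceil/5 n))

⌈n/5⌉-least : ∀ n a → n ≤ 5 * a → ⌈ n /5⌉ ≤ a
⌈n/5⌉-least n a n≤5a with ⌈ n /5⌉ ≤? a
... | yes ≤a = ≤a
... | no ≰a = ⊥-elim (<-irrefl refl (<-≤-trans 5a+4<5[a+1] (≤-trans (*-monoʳ-≤ 5 (≰⇒> ≰a)) 5⌈n/5⌉≤5a+4)))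
  where
  5⌈n/5⌉≤5a+4 : 5 * ⌈ n /5⌉ ≤ 5 * a + 4
  5⌈n/5⌉≤5a+4 = ≤-trans (5*⌈n/5⌉≤n+4 n) (+-monoˡ-≤ 4 n≤5a)
  5a+4<5[a+1] : 5 * a + 4 < 5 * suc a
  5a+4<5[a+1] = ≤-reflexive (trans (cong suc (+-comm (5 * a) 4)) (sym (*-suc 5 a)))

AllMapInto : ∀ {n} → Subset n → Subset n → Matchings n → Bool
AllMapInto A T M = every (MapsInto A T) M

every-intro : ∀ {A : Set} {k} (q : A → Bool) (v : Vec A k) → (∀ i → q (lookup v i) ≡ true) → every q v ≡ true
every-intro q [] h = refl
every-intro q (x ∷ v) h = ∧-intro (h zero) (every-intro q v (λ i → h (suc i)))

HasSizes : ∀ {n} → ℕ → ℕ → Subset n → Subset n → Bool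
HasSizes a t A T = (∣ A ∣ ≡ᵇ a) ∧ (∣ T ∣ ≡ᵇ t)

witnesses : ∀ {n} (a t : ℕ) (E₁ E₂ : Subset n → Subset n → Subset n) → Matchings n → ℕ
witnesses {n} a t E₁ E₂ M =
  sumBy (λ A → sumBy (λ T → 𝟙 (HasSizes a t A T ∧ AllMapInto (E₁ A T) (E₂ A T) M)) (allSubsets n)) (allSubsets n)

witnesses-positive : ∀ {n} a t (E₁ E₂ : Subset n → Subset n → Subset n) (M : Matchings n) (A T : Subset n) →
  ∣ A ∣ ≡ a → ∣ T ∣ ≡ t → (∀ i x → lookup (E₁ A T) x ≡ true → lookup (E₂ A T) (lookup (lookup M i) x) ≡ true) →
  1 ≤ witnesses a t E₁ E₂ M
witnesses-positive {n} a t E₁ E₂ M A T refl refl maps = begin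
    1
  ≡⟨ cong 𝟙 (∧-intro (∧-intro (≡ᵇ-refl ∣ A ∣) (≡ᵇ-refl ∣ T ∣)) all-map) ⟨
    term A T
  ≤⟨ ≤-sumBy-allSubsets (term A) T ⟩
    sumBy (term A) (allSubsets n)
  ≤⟨ ≤-sumBy-allSubsets (λ A → sumBy (term A) (allSubsets n)) A ⟩
    witnesses a t E₁ E₂ M ∎
  where
  open ≤-Reasoning
  term : Subset n → Subset n → ℕ
  term A T = 𝟙 (HasSizes a t A T ∧ AllMapInto (E₁ A T) (E₂ A T) M)
  all-map : AllMapInto (E₁ A T) (E₂ A T) M ≡ true
  all-map = every-intro _ M (λ i → mapsInto-complete (E₁ A T) (E₂ A T) (lookup M i) (maps i))

sumBelow-positive : ∀ (f : ℕ → ℕ) L s → s < L → 1 ≤ f s → 1 ≤ sumBelow f L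
sumBelow-positive f L s s<L 1≤fs = ≤-trans 1≤fs (sumBelow-≥ f L s s<L)

sizeInRange : ℕ → ℕ → Bool
sizeInRange n s = (1 ≤ᵇ s) ∧ (4 * s ≤ᵇ n)

Φ₁ : ∀ {n} → Matchings n → ℕ
Φ₁ {n} M = sumBelow (λ s → 𝟙 (sizeInRange n s) * witnesses s (2 * s ∸ 1) (λ A T → A) (λ A T → T) M) (suc n)

Φ₂ : ∀ {n} → Matchings n → ℕ
Φ₂ {n} M = sumBelow (λ s → 𝟙 (sizeInRange n s) * witnesses s (2 * s ∸ 1) (λ B S → ∁ S) (λ B S → ∁ B) M) (suc n)

Φ₃ : ∀ {n} → Matchings n → ℕ
Φ₃ {n} M = witnesses ⌈ n /5⌉ ⌈ n /5⌉ (λ A B → A) (λ A B → ∁ B) M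

Φ : ∀ {n} → Matchings n → ℕ
Φ M = Φ₁ M + Φ₂ M + Φ₃ M

edge-matching : ∀ {n} (M : Matchings n) (i : Fin 25) x → edgeᵇ M x (lookup (lookup M i) x) ≡ true
edge-matching M i x = any-tabulate⁺ (λ j → ⌊ lookup (lookup M j) x ≟ y ⌋) (λ j → j) i (⌊≟⌋-refl y)
  where
  y = lookup (lookup M i) x
  ⌊≟⌋-refl : ∀ {n} (y : Fin n) → ⌊ y ≟ y ⌋ ≡ true
  ⌊≟⌋-refl y with y ≟ y
  ... | yes _ = refl
  ... | no y≢y = ⊥-elim (y≢y refl)

∨-false-elim : ∀ {a b} → a ∨ b ≡ false → a ≡ false × b ≡ false
∨-false-elim {false} e = refl , e

not-false-elim : ∀ {u} → not u ≡ false → u ≡ true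
not-false-elim {true} _ = refl

<⇒≤∸1 : ∀ {m n} → m < n → m ≤ n ∸ 1
<⇒≤∸1 (s≤s m≤n) = m≤n

sizeInRange-intro : ∀ n s → 1 ≤ s → 4 * s ≤ n → sizeInRange n s ≡ true
sizeInRange-intro n s 1≤s 4s≤n = ∧-intro (≤⇒≤ᵇ-true 1 s 1≤s) (≤⇒≤ᵇ-true (4 * s) n 4s≤n)

module NonExpanding {n} (M : Matchings n) (N : Subset n) (s : ℕ)
  (4s≤n : 4 * s ≤ n) (small : ¬ (2 * s ≤ ∣ N ∣)) where

  1≤s : 1 ≤ s
  1≤s = positive-size s small
    where
    positive-size : ∀ s → ¬ (2 * s ≤ ∣ N ∣) → 1 ≤ s
    positive-size zero small = ⊥-elim (small z≤n)
    positive-size (suc _) _ = s≤s z≤n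

  neighbourhood : ∃ λ T → (∀ i → lookup N i ≡ true → lookup T i ≡ true) × ∣ T ∣ ≡ 2 * s ∸ 1
  neighbourhood = superset-of-size N (2 * s ∸ 1) (<⇒≤∸1 (≰⇒> small))
    (≤-trans (m∸n≤m (2 * s) 1) (≤-trans (*-monoˡ-≤ s {2} {4} (s≤s (s≤s z≤n))) 4s≤n))

  positive : ∀ (E₁ E₂ : Subset n → Subset n → Subset n) (A : Subset n) → ∣ A ∣ ≡ s →
    (∀ i x → lookup (E₁ A (proj₁ neighbourhood)) x ≡ true → lookup (E₂ A (proj₁ neighbourhood)) (lookup (lookup M i) x) ≡ true) →
    1 ≤ sumBelow (λ s → 𝟙 (sizeInRange n s) * witnesses s (2 * s ∸ 1) E₁ E₂ M) (suc n)
  positive E₁ E₂ A ∣A∣≡s maps = sumBelow-positive _ (suc n) s (s≤s (subst (_≤ n) ∣A∣≡s (∣p∣≤n A)))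
    (subst (λ b → 1 ≤ 𝟙 b * witnesses s (2 * s ∸ 1) E₁ E₂ M) (sym (sizeInRange-intro n s 1≤s 4s≤n))
      (≤-trans (witnesses-positive s (2 * s ∸ 1) E₁ E₂ M A _ ∣A∣≡s (proj₂ (proj₂ neighbourhood)) maps)
               (≤-reflexive (sym (+-identityʳ _)))))

prop-i-failure⇒Φ₁ : ∀ {n} (M : Matchings n) → prop-i M ≡ false → 1 ≤ Φ₁ M
prop-i-failure⇒Φ₁ {n} M e with all-false⇒counterexample _ (allSubsets n) e
... | A , eA with ∨-false-elim {not (4 * ∣ A ∣ ≤ᵇ n)} eA
... | small , not-expanding = positive (λ A T → A) (λ A T → T) A refl (λ i x x∈A → N⊆T _ (in-NX i x x∈A))
  where
  open NonExpanding M (NX M A) ∣ A ∣ (≤ᵇ-true⇒≤ _ n (not-false-elim small))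
    (λ 2s≤N → case trans (sym (≤⇒≤ᵇ-true _ _ 2s≤N)) not-expanding of λ ())
  N⊆T = proj₁ (proj₂ neighbourhood)
  in-NX : ∀ i x → lookup A x ≡ true → lookup (NX M A) (lookup (lookup M i) x) ≡ true
  in-NX i x x∈A = trans (lookup∘tabulate _ (lookup (lookup M i) x))
    (any-tabulate⁺ _ (λ j → j) x (∧-intro x∈A (edge-matching M i x)))

prop-ii-failure⇒Φ₂ : ∀ {n} (M : Matchings n) → prop-ii M ≡ false → 1 ≤ Φ₂ M
prop-ii-failure⇒Φ₂ {n} M e with all-false⇒counterexample _ (allSubsets n) e
... | B , eB with ∨-false-elim {not (4 * ∣ B ∣ ≤ᵇ n)} eB
... | small , not-expanding = positive (λ B S → ∁ S) (λ B S → ∁ B) B refl maps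
  where
  open NonExpanding M (NY M B) ∣ B ∣ (≤ᵇ-true⇒≤ _ n (not-false-elim small))
    (λ 2s≤N → case trans (sym (≤⇒≤ᵇ-true _ _ 2s≤N)) not-expanding of λ ())
  S = proj₁ neighbourhood
  N⊆S = proj₁ (proj₂ neighbourhood)
  in-NY : ∀ i x → lookup B (lookup (lookup M i) x) ≡ true → lookup (NY M B) x ≡ true
  in-NY i x y∈B = trans (lookup∘tabulate _ x)
    (any-tabulate⁺ (λ y → lookup B y ∧ edgeᵇ M x y) (λ j → j) (lookup (lookup M i) x) (∧-intro y∈B (edge-matching M i x)))
  maps : ∀ i x → lookup (∁ S) x ≡ true → lookup (∁ B) (lookup (lookup M i) x) ≡ true
  maps i x x∉S with lookup B (lookup (lookup M i) x) in y∈B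
  ... | false = trans (lookup-∁ B _) (cong not y∈B)
  ... | true with () ← trans (sym (trans (lookup-∁ S x) (cong not (N⊆S x (in-NY i x y∈B))))) x∉S

prop-iii-failure⇒Φ₃ : ∀ {n} (M : Matchings n) → prop-iii M ≡ false → 1 ≤ Φ₃ M
prop-iii-failure⇒Φ₃ {n} M e with all-false⇒counterexample _ (allSubsets n) e
... | A , eA with all-false⇒counterexample _ (allSubsets n) eA
... | B , eB with ∨-false-elim {not ((n ≤ᵇ (5 * ∣ A ∣)) ∧ (n ≤ᵇ (5 * ∣ B ∣)))} eB
... | large , no-edge = witnesses-positive m m (λ A B → A) (λ A B → ∁ B) M A' B' ∣A'∣≡m ∣B'∣≡m maps
  where
  m = ⌈ n /5⌉
  n≤5∣A∣ = ≤ᵇ-true⇒≤ n _ (∧-elimˡ (not-false-elim large))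
  n≤5∣B∣ = ≤ᵇ-true⇒≤ n _ (∧-elimʳ {n ≤ᵇ (5 * ∣ A ∣)} (not-false-elim large))
  A'-spec = subset-of-size A m (⌈n/5⌉-least n ∣ A ∣ n≤5∣A∣)
  B'-spec = subset-of-size B m (⌈n/5⌉-least n ∣ B ∣ n≤5∣B∣)
  A' = proj₁ A'-spec
  B' = proj₁ B'-spec
  ∣A'∣≡m = proj₂ (proj₂ A'-spec)
  ∣B'∣≡m = proj₂ (proj₂ B'-spec)
  no-edge-at : ∀ x y → (lookup A x ∧ (lookup B y ∧ edgeᵇ M x y)) ≡ false
  no-edge-at x y = any-tabulate-false (λ y → lookup A x ∧ (lookup B y ∧ edgeᵇ M x y)) (λ j → j)
    (any-tabulate-false (λ x → anyF λ y → lookup A x ∧ (lookup B y ∧ edgeᵇ M x y)) (λ j → j) no-edge x) y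
  maps : ∀ i x → lookup A' x ≡ true → lookup (∁ B') (lookup (lookup M i) x) ≡ true
  maps i x x∈A' with lookup B' (lookup (lookup M i) x) in y∈B'
  ... | false = trans (lookup-∁ B' _) (cong not y∈B')
  ... | true with () ← trans (sym (no-edge-at x (lookup (lookup M i) x)))
        (∧-intro (proj₁ (proj₂ A'-spec) x x∈A') (∧-intro (proj₁ (proj₂ B'-spec) _ y∈B') (edge-matching M i x)))

bad⇒Φ : ∀ {n} (M : Matchings n) → not (good M) ≡ true → 1 ≤ Φ M
bad⇒Φ M e with prop-i M in e₁ | prop-ii M in e₂ | prop-iii M in e₃
... | false | _ | _ = ≤-trans (prop-i-failure⇒Φ₁ M e₁) (≤-trans (m≤m+n _ _) (m≤m+n _ _))
... | true | false | _ = ≤-trans (prop-ii-failure⇒Φ₂ M e₂) (≤-trans (m≤n+m _ (Φ₁ M)) (m≤m+n _ _))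
... | true | true | false = ≤-trans (prop-iii-failure⇒Φ₃ M e₃) (m≤n+m _ _)

count-mapsInto-sized : ∀ {n} (A T : Subset n) {a t} → ∣ A ∣ ≡ a → ∣ T ∣ ≡ t →
  count (MapsInto A T) (perfectMatchings n) ≤ falling t a * (n ∸ a) !
count-mapsInto-sized A T refl refl = count-perfectMatchings-mapsInto A T

sumBy-witnesses : ∀ {n} a t (E₁ E₂ : Subset n → Subset n → Subset n) K →
  (∀ A T → ∣ A ∣ ≡ a → ∣ T ∣ ≡ t → count (MapsInto (E₁ A T) (E₂ A T)) (perfectMatchings n) ≤ K) →
  sumBy (witnesses a t E₁ E₂) (sampleSpace n) ≤ choose n a * (choose n t * K ^ 25)
sumBy-witnesses {n} a t E₁ E₂ K count≤K = begin
    sumBy (λ M → sumBy (λ A → sumBy (λ T → f A T M) SS) SS) Sm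
  ≡⟨ sumBy-comm (λ M A → sumBy (λ T → f A T M) SS) Sm SS ⟩
    sumBy (λ A → sumBy (λ M → sumBy (λ T → f A T M) SS) Sm) SS
  ≡⟨ sumBy-cong SS (λ A → sumBy-comm (λ M T → f A T M) Sm SS) ⟩
    sumBy (λ A → sumBy (λ T → sumBy (λ M → f A T M) Sm) SS) SS
  ≤⟨ sumBy-mono-≤ SS (λ A → sumBy-mono-≤ SS (λ T → per-pair A T)) ⟩
    sumBy (λ A → sumBy (λ T → 𝟙 (∣ A ∣ ≡ᵇ a) * (𝟙 (∣ T ∣ ≡ᵇ t) * K ^ 25)) SS) SS
  ≡⟨ sumBy-cong SS (λ A → trans (sumBy-*ˡ (𝟙 (∣ A ∣ ≡ᵇ a)) _ SS) (cong (𝟙 (∣ A ∣ ≡ᵇ a) *_) (sumBy-sized t))) ⟩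
    sumBy (λ A → 𝟙 (∣ A ∣ ≡ᵇ a) * (choose n t * K ^ 25)) SS
  ≡⟨ sumBy-sized a ⟩
    choose n a * (choose n t * K ^ 25) ∎
  where
  open ≤-Reasoning
  SS = allSubsets n
  Sm = sampleSpace n
  f : Subset n → Subset n → Matchings n → ℕ
  f A T M = 𝟙 (HasSizes a t A T ∧ AllMapInto (E₁ A T) (E₂ A T) M)
  sumBy-sized : ∀ s {c} → sumBy (λ A → 𝟙 (∣ A ∣ ≡ᵇ s) * c) SS ≡ choose n s * c
  sumBy-sized s = trans (sumBy-𝟙-* _ _ SS) (cong (_* _) (count-subsets-of-size n s))
  per-pair : ∀ A T → sumBy (λ M → 𝟙 (((∣ A ∣ ≡ᵇ a) ∧ (∣ T ∣ ≡ᵇ t)) ∧ AllMapInto (E₁ A T) (E₂ A T) M)) Sm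
                       ≤ 𝟙 (∣ A ∣ ≡ᵇ a) * (𝟙 (∣ T ∣ ≡ᵇ t) * K ^ 25)
  per-pair A T with ∣ A ∣ ≡ᵇ a in ea | ∣ T ∣ ≡ᵇ t in et
  ... | false | _ = ≤-reflexive (sumBy-0 Sm)
  ... | true | false = ≤-reflexive (sumBy-0 Sm)
  ... | true | true = begin
      sumBy (λ M → 𝟙 (AllMapInto (E₁ A T) (E₂ A T) M)) Sm
    ≡⟨ count≡sumBy-𝟙 _ Sm ⟨
      count (every (MapsInto (E₁ A T) (E₂ A T))) Sm
    ≡⟨ count-every-allVecs _ (perfectMatchings n) 25 ⟩
      count (MapsInto (E₁ A T) (E₂ A T)) (perfectMatchings n) ^ 25
    ≤⟨ ^-monoˡ-≤ 25 (count≤K A T (≡ᵇ-true⇒≡ _ _ ea) (≡ᵇ-true⇒≡ _ _ et)) ⟩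
      K ^ 25
    ≡⟨ sym (trans (+-identityʳ _) (+-identityʳ _)) ⟩
      1 * (1 * K ^ 25) ∎

sumBy-sumBelow-≤ : ∀ {A : Set} (xs : List A) (r : ℕ → Bool) (w : ℕ → A → ℕ) (B : ℕ → ℕ) L →
  (∀ s → sumBy (w s) xs ≤ B s) →
  sumBy (λ x → sumBelow (λ s → 𝟙 (r s) * w s x) L) xs ≤ sumBelow (λ s → 𝟙 (r s) * B s) L
sumBy-sumBelow-≤ xs r w B L h = ≤-trans (≤-reflexive (sumBy-sumBelow (λ s x → 𝟙 (r s) * w s x) xs L))
  (sumBelow-mono-≤ _ _ L (λ s → ≤-trans (≤-reflexive (sumBy-*ˡ (𝟙 (r s)) (w s) xs)) (*-monoʳ-≤ (𝟙 (r s)) (h s))))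

expansionCount : ℕ → ℕ → ℕ
expansionCount n s = falling (2 * s ∸ 1) s * (n ∸ s) !

expansionCount′ : ℕ → ℕ → ℕ
expansionCount′ n s = falling (n ∸ s) (n ∸ (2 * s ∸ 1)) * (n ∸ (n ∸ (2 * s ∸ 1))) !

sparseCount : ℕ → ℕ → ℕ
sparseCount n m = falling (n ∸ m) m * (n ∸ m) !

Σ₁ : ℕ → ℕ
Σ₁ n = sumBelow (λ s → 𝟙 (sizeInRange n s) * (choose n s * (choose n (2 * s ∸ 1) * expansionCount n s ^ 25))) (suc n)

Σ₂ : ℕ → ℕ
Σ₂ n = sumBelow (λ s → 𝟙 (sizeInRange n s) * (choose n s * (choose n (2 * s ∸ 1) * expansionCount′ n s ^ 25))) (suc n)

Σ₃ : ℕ → ℕ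
Σ₃ n = choose n ⌈ n /5⌉ * (choose n ⌈ n /5⌉ * sparseCount n ⌈ n /5⌉ ^ 25)

sumBy-Φ₁ : ∀ n → sumBy Φ₁ (sampleSpace n) ≤ Σ₁ n
sumBy-Φ₁ n = sumBy-sumBelow-≤ (sampleSpace n) (sizeInRange n) _ _ (suc n)
  (λ s → sumBy-witnesses s (2 * s ∸ 1) (λ A T → A) (λ A T → T) (expansionCount n s) (λ A T → count-mapsInto-sized A T))

sumBy-Φ₂ : ∀ n → sumBy Φ₂ (sampleSpace n) ≤ Σ₂ n
sumBy-Φ₂ n = sumBy-sumBelow-≤ (sampleSpace n) (sizeInRange n) _ _ (suc n)
  (λ s → sumBy-witnesses s (2 * s ∸ 1) (λ B S → ∁ S) (λ B S → ∁ B) (expansionCount′ n s)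
    (λ B S ∣B∣≡s ∣S∣≡t → count-mapsInto-sized (∁ S) (∁ B) (∣∁∣≡ S ∣S∣≡t) (∣∁∣≡ B ∣B∣≡s)))
  where
  ∣∁∣≡ : ∀ (A : Subset n) {a} → ∣ A ∣ ≡ a → ∣ ∁ A ∣ ≡ n ∸ a
  ∣∁∣≡ A ∣A∣≡a = trans (∣∁p∣≡n∸∣p∣ A) (cong (n ∸_) ∣A∣≡a)

sumBy-Φ₃ : ∀ n → sumBy Φ₃ (sampleSpace n) ≤ Σ₃ n
sumBy-Φ₃ n = sumBy-witnesses ⌈ n /5⌉ ⌈ n /5⌉ (λ A B → A) (λ A B → ∁ B) (sparseCount n ⌈ n /5⌉)
  (λ A B ∣A∣≡m ∣B∣≡m → count-mapsInto-sized A (∁ B) ∣A∣≡m (trans (∣∁p∣≡n∸∣p∣ B) (cong (n ∸_) ∣B∣≡m)))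

badCount≤Σ : ∀ n → badCount n ≤ Σ₁ n + Σ₂ n + Σ₃ n
badCount≤Σ n = begin
    badCount n
  ≡⟨ length-filterᵇ (λ M → not (good M)) Sm ⟩
    count (λ M → not (good M)) Sm
  ≤⟨ union-bound (λ M → not (good M)) Φ Sm bad⇒Φ ⟩
    sumBy Φ Sm
  ≡⟨ trans (sumBy-+ (λ M → Φ₁ M + Φ₂ M) Φ₃ Sm) (cong (_+ sumBy Φ₃ Sm) (sumBy-+ Φ₁ Φ₂ Sm)) ⟩
    sumBy Φ₁ Sm + sumBy Φ₂ Sm + sumBy Φ₃ Sm
  ≤⟨ +-mono-≤ (+-mono-≤ (sumBy-Φ₁ n) (sumBy-Φ₂ n)) (sumBy-Φ₃ n) ⟩
    Σ₁ n + Σ₂ n + Σ₃ n ∎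
  where
  open ≤-Reasoning
  Sm = sampleSpace n

totalCount≡ : ∀ n → totalCount n ≡ (n !) ^ 25
totalCount≡ n = begin
    length (sampleSpace n)
  ≡⟨ length≡count-true (sampleSpace n) ⟩
    count (λ _ → true) (sampleSpace n)
  ≡⟨ count-cong _ _ (sampleSpace n) (λ M → sym (every-true M)) ⟩
    count (every (λ _ → true)) (sampleSpace n)
  ≡⟨ count-every-allVecs (λ _ → true) (perfectMatchings n) 25 ⟩
    count (λ _ → true) (perfectMatchings n) ^ 25
  ≡⟨ cong (_^ 25) (trans (sym (length≡count-true (perfectMatchings n))) (length-perfectMatchings n)) ⟩
    (n !) ^ 25 ∎
  where open ≡-Reasoning

^-distribʳ-* : ∀ a b k → (a * b) ^ k ≡ a ^ k * b ^ k
^-distribʳ-* a b zero = refl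
^-distribʳ-* a b (suc k) rewrite ^-distribʳ-* a b k = solve-∀-h a b (a ^ k) (b ^ k)
  where
  solve-∀-h : ∀ a b x y → a * b * (x * y) ≡ a * x * (b * y)
  solve-∀-h = solve-∀

choose-1 : ∀ n → choose n 1 ≡ n
choose-1 zero = refl
choose-1 (suc n) = cong suc (choose-1 n)

choose-absorb : ∀ n s → choose (suc n) (suc s) * suc s ≡ suc n * choose n s
choose-absorb n zero = trans (*-identityʳ _) (trans (choose-1 (suc n)) (sym (*-identityʳ (suc n))))
choose-absorb zero (suc s) = refl
choose-absorb (suc n) (suc s) = begin
    (choose (suc n) (suc s) + choose (suc n) (suc (suc s))) * suc (suc s)
  ≡⟨ regroup (choose (suc n) (suc s)) (choose (suc n) (suc (suc s))) s ⟩
    choose (suc n) (suc s) * suc s + choose (suc n) (suc s) + choose (suc n) (suc (suc s)) * suc (suc s)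
  ≡⟨ cong₂ (λ u v → u + choose (suc n) (suc s) + v) (choose-absorb n s) (choose-absorb n (suc s)) ⟩
    suc n * choose n s + (choose n s + choose n (suc s)) + suc n * choose n (suc s)
  ≡⟨ regroup′ n (choose n s) (choose n (suc s)) ⟩
    suc (suc n) * (choose n s + choose n (suc s)) ∎
  where
  open ≡-Reasoning
  regroup : ∀ x y s → (x + y) * suc (suc s) ≡ x * suc s + x + y * suc (suc s)
  regroup = solve-∀
  regroup′ : ∀ n a b → suc n * a + (a + b) + suc n * b ≡ suc (suc n) * (a + b)
  regroup′ = solve-∀

falling≡choose*! : ∀ n s → falling n s ≡ choose n s * s !
falling≡choose*! n zero = refl
falling≡choose*! zero (suc s) = refl
falling≡choose*! (suc n) (suc s) = begin
    suc n * falling n s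
  ≡⟨ cong (suc n *_) (falling≡choose*! n s) ⟩
    suc n * (choose n s * s !)
  ≡⟨ sym (*-assoc (suc n) (choose n s) (s !)) ⟩
    suc n * choose n s * s !
  ≡⟨ cong (_* s !) (sym (choose-absorb n s)) ⟩
    choose (suc n) (suc s) * suc s * s !
  ≡⟨ *-assoc (choose (suc n) (suc s)) (suc s) (s !) ⟩
    choose (suc n) (suc s) * (suc s) ! ∎
  where open ≡-Reasoning

falling*!≡! : ∀ n s → s ≤ n → falling n s * (n ∸ s) ! ≡ n !
falling*!≡! n zero _ = +-identityʳ _
falling*!≡! (suc n) (suc s) (s≤s le) = trans (*-assoc (suc n) (falling n s) _) (cong (suc n *_) (falling*!≡! n s le))

choose*!*!≡! : ∀ n s → s ≤ n → choose n s * s ! * (n ∸ s) ! ≡ n !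
choose*!*!≡! n s le = trans (cong (_* (n ∸ s) !) (sym (falling≡choose*! n s))) (falling*!≡! n s le)

choose≤2^ : ∀ n k → choose n k ≤ 2 ^ n
choose≤2^ n zero = ^-monoʳ-≤ 2 {0} {n} z≤n
choose≤2^ zero (suc k) = z≤n
choose≤2^ (suc n) (suc k) = ≤-trans (+-mono-≤ (choose≤2^ n k) (choose≤2^ n (suc k))) (≤-reflexive (cong (2 ^ n +_) (sym (+-identityʳ _))))

falling-monoˡ-≤ : ∀ a b r → a ≤ b → falling a r ≤ falling b r
falling-monoˡ-≤ a b zero le = ≤-refl
falling-monoˡ-≤ a b (suc r) le = *-mono-≤ le (falling-monoˡ-≤ (a ∸ 1) (b ∸ 1) r (∸-monoˡ-≤ 1 le))

falling-monoʳ-≤ : ∀ n u → suc u ≤ n → falling n u ≤ falling n (suc u)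
falling-monoʳ-≤ n u u<n rewrite falling-suc n u =
  m≤m*n (falling n u) (n ∸ u) {{>-nonZero (m<n⇒0<n∸m u<n)}}

falling*^≤falling*^ : ∀ t n s → t ≤ n → falling t s * n ^ s ≤ falling n s * t ^ s
falling*^≤falling*^ t n zero le = ≤-refl
falling*^≤falling*^ t n (suc s) le = begin
    falling t (suc s) * n ^ suc s
  ≡⟨ cong (_* n ^ suc s) (falling-suc t s) ⟩
    falling t s * (t ∸ s) * (n * n ^ s)
  ≡⟨ regroup (falling t s) (t ∸ s) n (n ^ s) ⟩
    falling t s * n ^ s * ((t ∸ s) * n)
  ≤⟨ *-mono-≤ (falling*^≤falling*^ t n s le) key ⟩
    falling n s * t ^ s * ((n ∸ s) * t)
  ≡⟨ regroup′ (falling n s) (t ^ s) (n ∸ s) t ⟩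
    falling n s * (n ∸ s) * (t * t ^ s)
  ≡⟨ cong (_* t ^ suc s) (sym (falling-suc n s)) ⟩
    falling n (suc s) * t ^ suc s ∎
  where
  open ≤-Reasoning
  regroup : ∀ a b n p → a * b * (n * p) ≡ a * p * (b * n)
  regroup = solve-∀
  regroup′ : ∀ a p b t → a * p * (b * t) ≡ a * b * (t * p)
  regroup′ = solve-∀
  key : (t ∸ s) * n ≤ (n ∸ s) * t
  key = begin
      (t ∸ s) * n
    ≡⟨ *-distribʳ-∸ n t s ⟩
      t * n ∸ s * n
    ≤⟨ ∸-monoʳ-≤ (t * n) (*-monoʳ-≤ s le) ⟩
      t * n ∸ s * t
    ≡⟨ cong (_∸ s * t) (*-comm t n) ⟩
      n * t ∸ s * t
    ≡⟨ sym (*-distribʳ-∸ t n s) ⟩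
      (n ∸ s) * t ∎

choose≤choose-suc : ∀ c k → choose c k ≤ choose (suc c) k
choose≤choose-suc c zero = ≤-refl
choose≤choose-suc c (suc k) = m≤n+m _ _

choose-monoˡ-≤ : ∀ a b k → a ≤ b → choose a k ≤ choose b k
choose-monoˡ-≤ zero zero k le = ≤-refl
choose-monoˡ-≤ a (suc b) k le with m≤n⇒m<n∨m≡n le
... | inj₂ refl = ≤-refl
... | inj₁ (s≤s lt) = ≤-trans (choose-monoˡ-≤ a b k lt) (choose≤choose-suc b k)

choose*falling*! : ∀ n s t → s ≤ n → choose n s * (falling t s * (n ∸ s) !) ≡ n ! * choose t s
choose*falling*! n s t le = begin
    choose n s * (falling t s * (n ∸ s) !)
  ≡⟨ cong (λ z → choose n s * (z * (n ∸ s) !)) (falling≡choose*! t s) ⟩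
    choose n s * (choose t s * s ! * (n ∸ s) !)
  ≡⟨ regroup (choose n s) (choose t s) (s !) ((n ∸ s) !) ⟩
    choose n s * s ! * (n ∸ s) ! * choose t s
  ≡⟨ cong (_* choose t s) (choose*!*!≡! n s le) ⟩
    n ! * choose t s ∎
  where
  open ≡-Reasoning
  regroup : ∀ a b c d → a * (b * c * d) ≡ a * c * d * b
  regroup = solve-∀

falling*!*^≤!*^ : ∀ n s t → t ≤ n → s ≤ n → falling t s * (n ∸ s) ! * n ^ s ≤ n ! * t ^ s
falling*!*^≤!*^ n s t tn sn = begin
    falling t s * (n ∸ s) ! * n ^ s
  ≡⟨ regroup (falling t s) ((n ∸ s) !) (n ^ s) ⟩
    falling t s * n ^ s * (n ∸ s) !
  ≤⟨ *-monoˡ-≤ ((n ∸ s) !) (falling*^≤falling*^ t n s tn) ⟩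
    falling n s * t ^ s * (n ∸ s) !
  ≡⟨ regroup (falling n s) (t ^ s) ((n ∸ s) !) ⟩
    falling n s * (n ∸ s) ! * t ^ s
  ≡⟨ cong (_* t ^ s) (falling*!≡! n s sn) ⟩
    n ! * t ^ s ∎
  where
  open ≤-Reasoning
  regroup : ∀ a b c → a * b * c ≡ a * c * b
  regroup = solve-∀

choose*falling²≤ : ∀ n u → suc u + u ≤ n →
  choose n (suc u + u) * ((falling (suc u + u) (suc u) * (n ∸ suc u) !) * (falling (suc u + u) (suc u) * (n ∸ suc u) !))
    ≤ n ! * n ! * suc u * choose (suc u + u) (suc u)
choose*falling²≤ n u tn = *-cancelʳ-≤ _ _ (u ! * u !) {{m*n≢0 (u !) (u !) {{u !≢0}} {{u !≢0}}}} (begin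
    choose n t * ((falling t s * (n ∸ s) !) * (falling t s * (n ∸ s) !)) * (u ! * u !)
  ≡⟨ regroup (choose n t) (falling t s) ((n ∸ s) !) (u !) ⟩
    choose n t * (falling t s * u !) * (falling t s * u !) * (n ∸ s) ! * (n ∸ s) !
  ≡⟨ cong (λ z → choose n t * z * z * (n ∸ s) ! * (n ∸ s) !) falling-t-s*u! ⟩
    choose n t * t ! * t ! * (n ∸ s) ! * (n ∸ s) !
  ≡⟨ cong (λ z → choose n t * t ! * t ! * z * (n ∸ s) !) [n∸s]!-split ⟩
    choose n t * t ! * t ! * (falling (n ∸ s) u * (n ∸ t) !) * (n ∸ s) !
  ≡⟨ regroup′ (choose n t) (t !) (falling (n ∸ s) u) ((n ∸ t) !) ((n ∸ s) !) ⟩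
    choose n t * t ! * (n ∸ t) ! * t ! * falling (n ∸ s) u * (n ∸ s) !
  ≡⟨ cong (λ z → z * t ! * falling (n ∸ s) u * (n ∸ s) !) (choose*!*!≡! n t tn) ⟩
    n ! * t ! * falling (n ∸ s) u * (n ∸ s) !
  ≤⟨ *-monoˡ-≤ ((n ∸ s) !) (*-monoʳ-≤ (n ! * t !) falling-n∸s-u≤) ⟩
    n ! * t ! * falling n s * (n ∸ s) !
  ≡⟨ trans (*-assoc (n ! * t !) (falling n s) _) (cong (n ! * t ! *_) (falling*!≡! n s sn)) ⟩
    n ! * t ! * n !
  ≡⟨ cong (λ z → n ! * z * n !) t!-split ⟩
    n ! * (choose t s * s ! * u !) * n !
  ≡⟨ regroup″ (n !) (choose t s) (suc u) (u !) ⟩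
    n ! * n ! * s * choose t s * (u ! * u !) ∎)
  where
  open ≤-Reasoning
  s = suc u
  t = suc u + u
  sn : s ≤ n
  sn = ≤-trans (m≤m+n s u) tn
  st : s ≤ t
  st = m≤m+n s u
  tsu : t ∸ s ≡ u
  tsu = m+n∸m≡n s u
  falling-t-s*u! : falling t s * u ! ≡ t !
  falling-t-s*u! = trans (cong (λ z → falling t s * z !) (sym tsu)) (falling*!≡! t s st)
  un : u ≤ n ∸ s
  un = subst (u ≤_) refl (≤-trans (≤-reflexive (sym (m+n∸m≡n s u))) (∸-monoˡ-≤ s tn))
  [n∸s]!-split : (n ∸ s) ! ≡ falling (n ∸ s) u * (n ∸ t) !
  [n∸s]!-split = sym (trans (cong (λ z → falling (n ∸ s) u * z !) (sym (∸-+-assoc n s u))) (falling*!≡! (n ∸ s) u un))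
  falling-n∸s-u≤ : falling (n ∸ s) u ≤ falling n s
  falling-n∸s-u≤ = ≤-trans (falling-monoˡ-≤ (n ∸ s) n u (m∸n≤m n s)) (falling-monoʳ-≤ n u sn)
  t!-split : t ! ≡ choose t s * s ! * u !
  t!-split = trans (sym (choose*!*!≡! t s st)) (cong (λ z → choose t s * s ! * z !) tsu)
  regroup : ∀ B f g v → B * ((f * g) * (f * g)) * (v * v) ≡ B * (f * v) * (f * v) * g * g
  regroup = solve-∀
  regroup′ : ∀ B T f g h → B * T * T * (f * g) * h ≡ B * T * g * T * f * h
  regroup′ = solve-∀
  regroup″ : ∀ F b s v → F * (b * (s * v) * v) * F ≡ F * F * s * b * (v * v)
  regroup″ = solve-∀

-- Used with t = 2s − 1, Bs = choose n s, Bt = choose n t, c = falling t s * (n ∸ s) !, F = n !, B = choose t s,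
-- N' = n ^ s, w = 2 ^ s, y = (2s) ^ s and T' = t ^ s.
expansion-inequality : ∀ (Bs Bt c F B N' w y s n T' : ℕ) →
  Bs * c ≡ F * B →
  Bt * (c * c) ≤ F * F * s * B →
  c * N' ≤ F * T' →
  B ≤ w * w → T' ≤ y → w * y ≤ N' → y * n ≤ (2 * s) * N' → s ≤ w → 1 ≤ w → 1 ≤ N' →
  Bs * (Bt * c ^ 25) * n ^ 3 * w ≤ 64 * F ^ 25
expansion-inequality Bs Bt c F B N' w y s n T' ea eb ec hB hT hwy hyn hsw hw hN =
  *-cancelʳ-≤ _ _ (N' ^ 22) {{N'²²≢0}} (begin
      Q * n ^ 3 * w * N' ^ 22
    ≡⟨ swap-tail Q (n ^ 3) w (N' ^ 22) ⟩
      Q * N' ^ 22 * (n ^ 3 * w)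
    ≤⟨ *-monoˡ-≤ (n ^ 3 * w) counts-bound ⟩
      F ^ 25 * (s * (w * w) * (w * w) * y ^ 22) * (n ^ 3 * w)
    ≡⟨ collect-w (F ^ 25) s w (y ^ 22) (n ^ 3) ⟩
      F ^ 25 * R
    ≤⟨ *-monoʳ-≤ (F ^ 25) powers-bound ⟩
      F ^ 25 * (64 * N' ^ 22)
    ≡⟨ pull-64 (F ^ 25) (N' ^ 22) ⟩
      64 * F ^ 25 * N' ^ 22 ∎)
  where
  open ≤-Reasoning
  x³-expand : ∀ x → x ^ 3 ≡ x * x * x
  x³-expand x = solve3 x
    where
    solve3 : ∀ x → x * (x * (x * 1)) ≡ x * x * x
    solve3 = solve-∀

  x²⁵-split : ∀ x → x ^ 25 ≡ x * x * x * x ^ 22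
  x²⁵-split x = trans (^-distribˡ-+-* x 3 22) (cong (_* x ^ 22) (x³-expand x))

  x²²-split : ∀ x → x ^ 22 ≡ x ^ 19 * (x * x * x)
  x²²-split x = trans (^-distribˡ-+-* x 19 3) (cong (x ^ 19 *_) (x³-expand x))

  pair-c : ∀ a b c C N → a * (b * (c * c * c * C)) * N ≡ (a * c) * (b * (c * c)) * (C * N)
  pair-c = solve-∀
  collect-F : ∀ F B s F22 T → (F * B) * (F * F * s * B) * (F22 * T) ≡ (F * F * F * F22) * (s * B * B * T)
  collect-F = solve-∀
  swap-tail : ∀ q a b d → q * a * b * d ≡ q * d * (a * b)
  swap-tail = solve-∀
  collect-w : ∀ G s w y m → G * (s * (w * w) * (w * w) * y) * (m * w) ≡ G * (s * (w * w * w * w * w) * y * m)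
  collect-w = solve-∀
  pull-64 : ∀ G M → G * (64 * M) ≡ 64 * G * M
  pull-64 = solve-∀
  pair-yn : ∀ s w Y19 y n W19 → s * (w * w * w * w * w) * (Y19 * (y * y * y)) * (n * n * n) * W19 ≡ s * (w * w * w * w * w) * (W19 * Y19) * ((y * n) * (y * n) * (y * n))
  pair-yn = solve-∀
  expand-2sN' : ∀ s w N19 N → s * (w * w * w * w * w) * N19 * (((2 * s) * N) * ((2 * s) * N) * ((2 * s) * N)) ≡ 8 * (s * s * s * s) * (w * w * w * w * w) * (N19 * (N * N * N))
  expand-2sN' = solve-∀
  collect-w⁹ : ∀ w W N → 8 * (w * w * w * w) * (w * w * w * w * w) * N ≡ 8 * (w * w * w * w * w * w * w * w * w) * N
  collect-w⁹ = solve-∀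
  N'²²≢0 : NonZero (N' ^ 22)
  N'²²≢0 = >-nonZero (^-monoˡ-≤ 22 hN)
  Q = Bs * (Bt * c ^ 25)
  W5 = w * w * w * w * w
  R = s * W5 * y ^ 22 * n ^ 3
  counts-bound : Q * N' ^ 22 ≤ F ^ 25 * (s * (w * w) * (w * w) * y ^ 22)
  counts-bound = begin
      Bs * (Bt * c ^ 25) * N' ^ 22
    ≡⟨ cong (λ z → Bs * (Bt * z) * N' ^ 22) (x²⁵-split c) ⟩
      Bs * (Bt * (c * c * c * c ^ 22)) * N' ^ 22
    ≡⟨ pair-c Bs Bt c (c ^ 22) (N' ^ 22) ⟩
      (Bs * c) * (Bt * (c * c)) * (c ^ 22 * N' ^ 22)
    ≡⟨ cong (λ z → (Bs * c) * (Bt * (c * c)) * z) (sym (^-distribʳ-* c N' 22)) ⟩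
      (Bs * c) * (Bt * (c * c)) * (c * N') ^ 22
    ≤⟨ *-mono-≤ (*-mono-≤ (≤-reflexive ea) eb) (^-monoˡ-≤ 22 ec) ⟩
      (F * B) * (F * F * s * B) * (F * T') ^ 22
    ≡⟨ cong (λ z → (F * B) * (F * F * s * B) * z) (^-distribʳ-* F T' 22) ⟩
      (F * B) * (F * F * s * B) * (F ^ 22 * T' ^ 22)
    ≡⟨ collect-F F B s (F ^ 22) (T' ^ 22) ⟩
      (F * F * F * F ^ 22) * (s * B * B * T' ^ 22)
    ≡⟨ cong (_* (s * B * B * T' ^ 22)) (sym (x²⁵-split F)) ⟩
      F ^ 25 * (s * B * B * T' ^ 22)
    ≤⟨ *-monoʳ-≤ (F ^ 25) (*-mono-≤ (*-mono-≤ (*-monoʳ-≤ s hB) hB) (^-monoˡ-≤ 22 hT)) ⟩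
      F ^ 25 * (s * (w * w) * (w * w) * y ^ 22) ∎
  w¹⁹≢0 : NonZero (w ^ 19)
  w¹⁹≢0 = >-nonZero (^-monoˡ-≤ 19 hw)
  powers-bound : R ≤ 64 * N' ^ 22
  powers-bound = *-cancelʳ-≤ _ _ (w ^ 19) {{w¹⁹≢0}} (begin
      s * W5 * y ^ 22 * n ^ 3 * w ^ 19
    ≡⟨ cong₂ (λ a b → s * W5 * a * b * w ^ 19) (x²²-split y) (x³-expand n) ⟩
      s * W5 * (y ^ 19 * (y * y * y)) * (n * n * n) * w ^ 19
    ≡⟨ pair-yn s w (y ^ 19) y n (w ^ 19) ⟩
      s * W5 * (w ^ 19 * y ^ 19) * ((y * n) * (y * n) * (y * n))
    ≡⟨ cong (λ z → s * W5 * z * ((y * n) * (y * n) * (y * n))) (sym (^-distribʳ-* w y 19)) ⟩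
      s * W5 * (w * y) ^ 19 * ((y * n) * (y * n) * (y * n))
    ≤⟨ *-mono-≤ (*-monoʳ-≤ (s * W5) (^-monoˡ-≤ 19 hwy)) (*-mono-≤ (*-mono-≤ hyn hyn) hyn) ⟩
      s * W5 * N' ^ 19 * (((2 * s) * N') * ((2 * s) * N') * ((2 * s) * N'))
    ≡⟨ expand-2sN' s w (N' ^ 19) N' ⟩
      8 * (s * s * s * s) * W5 * (N' ^ 19 * (N' * N' * N'))
    ≡⟨ cong (λ z → 8 * (s * s * s * s) * W5 * z) (sym (x²²-split N')) ⟩
      8 * (s * s * s * s) * W5 * N' ^ 22
    ≤⟨ *-monoˡ-≤ (N' ^ 22) (*-monoˡ-≤ W5 (*-monoʳ-≤ 8 (*-mono-≤ (*-mono-≤ (*-mono-≤ hsw hsw) hsw) hsw))) ⟩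
      8 * (w * w * w * w) * W5 * N' ^ 22
    ≡⟨ collect-w⁹ w (w ^ 19) (N' ^ 22) ⟩
      8 * (w * w * w * w * w * w * w * w * w) * N' ^ 22
    ≤⟨ *-monoˡ-≤ (N' ^ 22) (*-mono-≤ (m≤m+n 8 56) w⁹≤w¹⁹) ⟩
      64 * w ^ 19 * N' ^ 22
    ≡⟨ trans (*-assoc 64 (w ^ 19) _) (trans (cong (64 *_) (*-comm (w ^ 19) _)) (sym (*-assoc 64 (N' ^ 22) (w ^ 19)))) ⟩
      64 * N' ^ 22 * w ^ 19 ∎)
    where
    w⁹≤w¹⁹ : w * w * w * w * w * w * w * w * w ≤ w ^ 19
    w⁹≤w¹⁹ = begin
        w * w * w * w * w * w * w * w * w
      ≡⟨ w⁹-expand w ⟩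
        w ^ 9 * 1
      ≤⟨ *-monoʳ-≤ (w ^ 9) (^-monoˡ-≤ 10 hw) ⟩
        w ^ 9 * w ^ 10
      ≡⟨ sym (^-distribˡ-+-* w 9 10) ⟩
        w ^ 19 ∎
      where
      w⁹-expand : ∀ w → w * w * w * w * w * w * w * w * w ≡ w ^ 9 * 1
      w⁹-expand w = w⁹-solve w
        where
        w⁹-solve : ∀ w → w * w * w * w * w * w * w * w * w ≡ (w * (w * (w * (w * (w * (w * (w * (w * (w * 1))))))))) * 1
        w⁹-solve = solve-∀

2s∸1≡s+pred : ∀ u → 2 * suc u ∸ 1 ≡ suc u + u
2s∸1≡s+pred u = trans (cong (λ z → u + z) (+-identityʳ (suc u))) (trans (+-suc u u) refl)

n≤2^n : ∀ s → s ≤ 2 ^ s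
n≤2^n zero = z≤n
n≤2^n (suc s) = ≤-trans (+-mono-≤ (^-monoʳ-≤ 2 {0} {s} z≤n) (n≤2^n s)) (≤-reflexive (cong (2 ^ s +_) (sym (+-identityʳ (2 ^ s)))))

expansion-term-bound-suc : ∀ n u → 4 * suc u ≤ n → choose n (suc u) * (choose n (suc u + u) * (falling (suc u + u) (suc u) * (n ∸ suc u) !) ^ 25) * n ^ 3 * 2 ^ suc u ≤ 64 * (n !) ^ 25
expansion-term-bound-suc n u h4 =
  expansion-inequality (choose n s) (choose n t) (falling t s * (n ∸ s) !) (n !) (choose t s) (n ^ s) (2 ^ s) ((2 * s) ^ s) s n (t ^ s)
    (choose*falling*! n s t sn) (choose*falling²≤ n u tn) (falling*!*^≤!*^ n s t tn sn) hB hT hwy hyn (n≤2^n s) (^-monoʳ-≤ 2 {0} {s} z≤n) hN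
  where
  s = suc u
  t = suc u + u
  t≤2s : t ≤ 2 * s
  t≤2s = ≤-trans (+-monoʳ-≤ s (n≤1+n u)) (≤-reflexive (cong (s +_) (sym (+-identityʳ s))))
  s4 : 4 * s ≡ 2 * (2 * s)
  s4 = *-assoc 2 2 s
  2s≤n : 2 * s ≤ n
  2s≤n = ≤-trans (*-monoˡ-≤ s {2} {4} (s≤s (s≤s z≤n))) h4
  tn : t ≤ n
  tn = ≤-trans t≤2s 2s≤n
  sn : s ≤ n
  sn = ≤-trans (m≤m+n s u) tn
  hB : choose t s ≤ 2 ^ s * 2 ^ s
  hB = ≤-trans (choose≤2^ t s) (≤-trans (^-monoʳ-≤ 2 t≤2s) (≤-reflexive (trans (cong (2 ^_) (cong (s +_) (+-identityʳ s))) (^-distribˡ-+-* 2 s s))))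
  hT : t ^ s ≤ (2 * s) ^ s
  hT = ^-monoˡ-≤ s t≤2s
  hwy : 2 ^ s * (2 * s) ^ s ≤ n ^ s
  hwy = ≤-trans (≤-reflexive (sym (^-distribʳ-* 2 (2 * s) s))) (^-monoˡ-≤ s (≤-trans (≤-reflexive (sym s4)) h4))
  hyn : (2 * s) ^ s * n ≤ (2 * s) * n ^ s
  hyn = begin
      (2 * s) * (2 * s) ^ u * n
    ≡⟨ *-assoc (2 * s) ((2 * s) ^ u) n ⟩
      (2 * s) * ((2 * s) ^ u * n)
    ≤⟨ *-monoʳ-≤ (2 * s) (*-monoˡ-≤ n (^-monoˡ-≤ u 2s≤n)) ⟩
      (2 * s) * (n ^ u * n)
    ≡⟨ cong ((2 * s) *_) (*-comm (n ^ u) n) ⟩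
      (2 * s) * n ^ s ∎
    where open ≤-Reasoning
  hN : 1 ≤ n ^ s
  hN = ≤-trans (≤-reflexive (sym (^-zeroˡ s))) (^-monoˡ-≤ s {1} {n} (≤-trans (s≤s z≤n) sn))

expansion-term-bound : ∀ n s → 1 ≤ s → 4 * s ≤ n → choose n s * (choose n (2 * s ∸ 1) * expansionCount n s ^ 25) * n ^ 3 * 2 ^ s ≤ 64 * (n !) ^ 25
expansion-term-bound n (suc u) _ h4 = subst (λ z → z * n ^ 3 * 2 ^ suc u ≤ 64 * (n !) ^ 25) (sym eq) (expansion-term-bound-suc n u h4)
  where
  eq : choose n (suc u) * (choose n (2 * suc u ∸ 1) * expansionCount n (suc u) ^ 25) ≡ choose n (suc u) * (choose n (suc u + u) * (falling (suc u + u) (suc u) * (n ∸ suc u) !) ^ 25)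
  eq = cong (λ a → choose n (suc u) * (choose n a * (falling a (suc u) * (n ∸ suc u) !) ^ 25)) (2s∸1≡s+pred u)

falling-complement : ∀ n s u t → t ≡ s + u → t ≤ n → falling (n ∸ s) (n ∸ t) * t ! ≡ falling t s * (n ∸ s) !
falling-complement n s u t tsu tn = *-cancelʳ-≡ _ _ (u !) {{u !≢0}} (begin
    falling (n ∸ s) (n ∸ t) * t ! * u !
  ≡⟨ regroup (falling (n ∸ s) (n ∸ t)) (t !) (u !) ⟩
    falling (n ∸ s) (n ∸ t) * u ! * t !
  ≡⟨ cong (_* t !) falling*u!≡[n∸s]! ⟩
    (n ∸ s) ! * t !
  ≡⟨ cong ((n ∸ s) ! *_) (sym falling*u!≡t!) ⟩
    (n ∸ s) ! * (falling t s * u !)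
  ≡⟨ regroup′ ((n ∸ s) !) (falling t s) (u !) ⟩
    falling t s * (n ∸ s) ! * u ! ∎)
  where
  open ≡-Reasoning
  regroup : ∀ a b c → a * b * c ≡ a * c * b
  regroup = solve-∀
  regroup′ : ∀ a b c → a * (b * c) ≡ b * a * c
  regroup′ = solve-∀
  st : s ≤ t
  st = subst (s ≤_) (sym tsu) (m≤m+n s u)
  t∸s≡u : t ∸ s ≡ u
  t∸s≡u = trans (cong (_∸ s) tsu) (m+n∸m≡n s u)
  falling*u!≡t! : falling t s * u ! ≡ t !
  falling*u!≡t! = trans (cong (λ z → falling t s * z !) (sym t∸s≡u)) (falling*!≡! t s st)
  n∸s≡n∸t+u : n ∸ s ≡ (n ∸ t) + u
  n∸s≡n∸t+u = begin
      n ∸ s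
    ≡⟨ cong (_∸ s) (sym (m∸n+n≡m tn)) ⟩
      (n ∸ t) + t ∸ s
    ≡⟨ +-∸-assoc (n ∸ t) st ⟩
      (n ∸ t) + (t ∸ s)
    ≡⟨ cong ((n ∸ t) +_) t∸s≡u ⟩
      (n ∸ t) + u ∎
  falling*u!≡[n∸s]! : falling (n ∸ s) (n ∸ t) * u ! ≡ (n ∸ s) !
  falling*u!≡[n∸s]! = trans (cong (λ z → falling (n ∸ s) (n ∸ t) * z !) (sym (trans (cong (_∸ (n ∸ t)) n∸s≡n∸t+u) (m+n∸m≡n (n ∸ t) u))))
             (falling*!≡! (n ∸ s) (n ∸ t) (subst ((n ∸ t) ≤_) (sym n∸s≡n∸t+u) (m≤m+n (n ∸ t) u)))

expansionCount′≡expansionCount : ∀ n s → 1 ≤ s → 2 * s ∸ 1 ≤ n → expansionCount′ n s ≡ expansionCount n s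
expansionCount′≡expansionCount n (suc u) _ tn = begin
    falling (n ∸ s) (n ∸ t) * (n ∸ (n ∸ t)) !
  ≡⟨ cong (λ z → falling (n ∸ s) (n ∸ t) * z !) (m∸[m∸n]≡n tn) ⟩
    falling (n ∸ s) (n ∸ t) * t !
  ≡⟨ subst (λ z → falling (n ∸ s) (n ∸ z) * z ! ≡ falling z s * (n ∸ s) !) (sym (2s∸1≡s+pred u)) (falling-complement n s u (suc u + u) refl (subst (_≤ n) (2s∸1≡s+pred u) tn)) ⟩
    falling t s * (n ∸ s) ! ∎
  where
  open ≡-Reasoning
  s = suc u
  t = 2 * suc u ∸ 1

-- The slack 2K is what makes the induction on L go through.
geometric-bound′ : ∀ (f : ℕ → ℕ) K → f 0 ≡ 0 → (∀ s → f s * 2 ^ s ≤ K) → ∀ L → sumBelow f (suc L) * 2 ^ (suc L) + 2 * K ≤ K * 2 ^ (suc L)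
geometric-bound′ f K f0 hf zero rewrite f0 = ≤-reflexive (*-comm 2 K)
geometric-bound′ f K f0 hf (suc L) = begin
    (S + f (suc L)) * (2 * P) + 2 * K
  ≡⟨ regroup S (f (suc L)) P K ⟩
    2 * (S * P) + 2 * (f (suc L) * P) + 2 * K
  ≤⟨ +-monoˡ-≤ (2 * K) (+-monoʳ-≤ (2 * (S * P)) (*-monoʳ-≤ 2 (hf (suc L)))) ⟩
    2 * (S * P) + 2 * K + 2 * K
  ≡⟨ regroup′ (S * P) K ⟩
    2 * (S * P + 2 * K)
  ≤⟨ *-monoʳ-≤ 2 (geometric-bound′ f K f0 hf L) ⟩
    2 * (K * P)
  ≡⟨ regroup″ K P ⟩
    K * (2 * P) ∎
  where
  open ≤-Reasoning
  S = sumBelow f (suc L)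
  P = 2 ^ suc L
  regroup : ∀ S f P K → (S + f) * (2 * P) + 2 * K ≡ 2 * (S * P) + 2 * (f * P) + 2 * K
  regroup = solve-∀
  regroup′ : ∀ x K → 2 * x + 2 * K + 2 * K ≡ 2 * (x + 2 * K)
  regroup′ = solve-∀
  regroup″ : ∀ K P → 2 * (K * P) ≡ K * (2 * P)
  regroup″ = solve-∀

geometric-bound : ∀ (f : ℕ → ℕ) K → f 0 ≡ 0 → (∀ s → f s * 2 ^ s ≤ K) → ∀ L → sumBelow f (suc L) ≤ K
geometric-bound f K f0 hf L = *-cancelʳ-≤ _ _ (2 ^ suc L) {{>-nonZero (^-monoʳ-≤ 2 {0} {suc L} z≤n)}}
  (≤-trans (m≤m+n _ (2 * K)) (geometric-bound′ f K f0 hf L))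

choose-4m-ratio : ∀ m → choose (4 + 4 * m) (1 + m) * ((1 + m) * (3 + 3 * m) * (2 + 3 * m) * (1 + 3 * m))
             ≡ choose (4 * m) m * ((4 + 4 * m) * (3 + 4 * m) * (2 + 4 * m) * (1 + 4 * m))
choose-4m-ratio m = *-cancelʳ-≡ _ _ (m ! * x !) {{m*n≢0 (m !) (x !) {{m !≢0}} {{x !≢0}}}} (begin
    B' * ((1 + m) * (3 + x) * (2 + x) * (1 + x)) * (m ! * x !)
  ≡⟨ regroup₁ B' m x (m !) (x !) ⟩
    B' * (1 + m) ! * (3 + x) !
  ≡⟨ cong (λ z → B' * (1 + m) ! * z !) (sym 4+4m∸[1+m]≡3+x) ⟩
    B' * (1 + m) ! * ((4 + 4 * m) ∸ (1 + m)) !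
  ≡⟨ choose*!*!≡! (4 + 4 * m) (1 + m) (s≤s (≤-trans (m≤n*m m 4) (m≤n+m (4 * m) 3))) ⟩
    (4 + 4 * m) !
  ≡⟨ regroup₂ m ((4 * m) !) ⟩
    (4 + 4 * m) * (3 + 4 * m) * (2 + 4 * m) * (1 + 4 * m) * (4 * m) !
  ≡⟨ cong ((4 + 4 * m) * (3 + 4 * m) * (2 + 4 * m) * (1 + 4 * m) *_) (sym (choose*!*!≡! (4 * m) m (m≤n*m m 4))) ⟩
    (4 + 4 * m) * (3 + 4 * m) * (2 + 4 * m) * (1 + 4 * m) * (B * m ! * (4 * m ∸ m) !)
  ≡⟨ cong (λ z → (4 + 4 * m) * (3 + 4 * m) * (2 + 4 * m) * (1 + 4 * m) * (B * m ! * z !)) 4m∸m≡x ⟩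
    (4 + 4 * m) * (3 + 4 * m) * (2 + 4 * m) * (1 + 4 * m) * (B * m ! * x !)
  ≡⟨ regroup₃ m B (m !) (x !) ⟩
    B * ((4 + 4 * m) * (3 + 4 * m) * (2 + 4 * m) * (1 + 4 * m)) * (m ! * x !) ∎)
  where
  open ≡-Reasoning
  x = 3 * m
  B' = choose (4 + 4 * m) (1 + m)
  B = choose (4 * m) m
  regroup₁ : ∀ b m x p q → b * ((1 + m) * (3 + x) * (2 + x) * (1 + x)) * (p * q) ≡ b * ((1 + m) * p) * ((3 + x) * ((2 + x) * ((1 + x) * q)))
  regroup₁ = solve-∀
  regroup₂ : ∀ m f → (4 + 4 * m) * ((3 + 4 * m) * ((2 + 4 * m) * ((1 + 4 * m) * f))) ≡ (4 + 4 * m) * (3 + 4 * m) * (2 + 4 * m) * (1 + 4 * m) * f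
  regroup₂ = solve-∀
  regroup₃ : ∀ m b p q → (4 + 4 * m) * (3 + 4 * m) * (2 + 4 * m) * (1 + 4 * m) * (b * p * q) ≡ b * ((4 + 4 * m) * (3 + 4 * m) * (2 + 4 * m) * (1 + 4 * m)) * (p * q)
  regroup₃ = solve-∀
  4m∸m≡x : 4 * m ∸ m ≡ x
  4m∸m≡x = m+n∸m≡n m (3 * m)
  4+4m∸[1+m]≡3+x : (4 + 4 * m) ∸ (1 + m) ≡ 3 + x
  4+4m∸[1+m]≡3+x = trans (cong (_∸ m) (cong (3 +_) refl)) (trans (cong (_∸ m) (regroup₄ m)) (m+n∸m≡n m (3 + x)))
    where
    regroup₄ : ∀ m → 3 + 4 * m ≡ m + (3 + 3 * m)
    regroup₄ = solve-∀

choose-4m-m≤10^m : ∀ m → choose (4 * m) m ≤ 10 ^ m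
choose-4m-m≤10^m zero = s≤s z≤n
choose-4m-m≤10^m (suc m) = subst (λ z → choose z (suc m) ≤ 10 ^ suc m) (sym (*-suc 4 m))
  (*-cancelʳ-≤ _ _ D {{>-nonZero (s≤s z≤n)}} (begin
    choose (4 + 4 * m) (1 + m) * D
  ≡⟨ choose-4m-ratio m ⟩
    choose (4 * m) m * Nn
  ≤⟨ *-mono-≤ (choose-4m-m≤10^m m) (m≤m+n Nn _) ⟩
    10 ^ m * (Nn + (1 + m) * (14 * m * m * m + 156 * m * m + 154 * m + 36))
  ≡⟨ cong (10 ^ m *_) (poly m) ⟩
    10 ^ m * (10 * D)
  ≡⟨ regroup (10 ^ m) D ⟩
    10 ^ suc m * D ∎))
  where
  open ≤-Reasoning
  D = (1 + m) * (3 + 3 * m) * (2 + 3 * m) * (1 + 3 * m)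
  Nn = (4 + 4 * m) * (3 + 4 * m) * (2 + 4 * m) * (1 + 4 * m)
  poly : ∀ m → (4 + 4 * m) * (3 + 4 * m) * (2 + 4 * m) * (1 + 4 * m) + (1 + m) * (14 * m * m * m + 156 * m * m + 154 * m + 36)
           ≡ 10 * ((1 + m) * (3 + 3 * m) * (2 + 3 * m) * (1 + 3 * m))
  poly = solve-∀
  regroup : ∀ p d → p * (10 * d) ≡ 10 * p * d
  regroup = solve-∀

cube : ℕ → ℕ
cube m = m * m * m

2^m*m³≤21*3^m-from7 : ∀ d → 2 ^ (7 + d) * cube (7 + d) ≤ 21 * 3 ^ (7 + d)
2^m*m³≤21*3^m-from7 zero = ≤ᵇ-true⇒≤ (2 ^ 7 * cube 7) (21 * 3 ^ 7) refl
2^m*m³≤21*3^m-from7 (suc d) = begin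
    2 * 2 ^ (7 + d) * cube (8 + d)
  ≡⟨ *-assoc 2 (2 ^ (7 + d)) _ ⟩
    2 * (2 ^ (7 + d) * cube (8 + d))
  ≡⟨ regroup₁ (2 ^ (7 + d)) (cube (8 + d)) ⟩
    2 ^ (7 + d) * (2 * cube (8 + d))
  ≤⟨ *-monoʳ-≤ (2 ^ (7 + d)) (≤-trans (m≤m+n _ _) (≤-reflexive (sym (poly d)))) ⟩
    2 ^ (7 + d) * (3 * cube (7 + d))
  ≡⟨ regroup₂ (2 ^ (7 + d)) (cube (7 + d)) ⟩
    3 * (2 ^ (7 + d) * cube (7 + d))
  ≤⟨ *-monoʳ-≤ 3 (2^m*m³≤21*3^m-from7 d) ⟩
    3 * (21 * 3 ^ (7 + d))
  ≡⟨ regroup₃ (3 ^ (7 + d)) ⟩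
    21 * (3 * 3 ^ (7 + d)) ∎
  where
  open ≤-Reasoning
  regroup₁ : ∀ p c → 2 * (p * c) ≡ p * (2 * c)
  regroup₁ = solve-∀
  regroup₂ : ∀ p c → p * (3 * c) ≡ 3 * (p * c)
  regroup₂ = solve-∀
  regroup₃ : ∀ p → 3 * (21 * p) ≡ 21 * (3 * p)
  regroup₃ = solve-∀
  poly : ∀ d → 3 * ((7 + d) * (7 + d) * (7 + d)) ≡ 2 * ((8 + d) * (8 + d) * (8 + d)) + (5 + 57 * d + 15 * d * d + d * d * d)
  poly = solve-∀

2^m*m³≤21*3^m : ∀ m → 2 ^ m * cube m ≤ 21 * 3 ^ m
2^m*m³≤21*3^m 0 = z≤n
2^m*m³≤21*3^m 1 = ≤ᵇ-true⇒≤ _ _ refl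
2^m*m³≤21*3^m 2 = ≤ᵇ-true⇒≤ _ _ refl
2^m*m³≤21*3^m 3 = ≤ᵇ-true⇒≤ _ _ refl
2^m*m³≤21*3^m 4 = ≤ᵇ-true⇒≤ _ _ refl
2^m*m³≤21*3^m 5 = ≤ᵇ-true⇒≤ _ _ refl
2^m*m³≤21*3^m 6 = ≤ᵇ-true⇒≤ _ _ refl
2^m*m³≤21*3^m (suc (suc (suc (suc (suc (suc (suc d))))))) = 2^m*m³≤21*3^m-from7 d

-- Used with Bm = choose n m, c = sparseCount n m, F = n !, Bb = choose (n ∸ m) m, N' = n ^ m, Z = (n ∸ m) ^ m, q = 10 ^ m.
sparse-inequality : ∀ (Bm c F Bb N' Z 5ᵐ 4ᵐ q 3ᵐ 2ᵐ : ℕ) →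
  Bm * c ≡ F * Bb → c * N' ≤ F * Z → 5ᵐ * Z ≤ 4ᵐ * N' → Bb ≤ q → q * q * 4ᵐ ^ 23 * 3ᵐ ≤ 2ᵐ * 5ᵐ ^ 23 → 1 ≤ N' → 1 ≤ 5ᵐ →
  Bm * (Bm * c ^ 25) * 3ᵐ ≤ F ^ 25 * 2ᵐ
sparse-inequality Bm c F Bb N' Z 5ᵐ 4ᵐ q 3ᵐ 2ᵐ ea ec h1 h2 h3 hN h5 =
  *-cancelʳ-≤ _ _ (N' ^ 23 * 5ᵐ ^ 23) {{m*n≢0 _ _ {{>-nonZero (^-monoˡ-≤ 23 hN)}} {{>-nonZero (^-monoˡ-≤ 23 h5)}}}} (begin
    Bm * (Bm * c ^ 25) * 3ᵐ * (N' ^ 23 * 5ᵐ ^ 23)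
  ≡⟨ cong (λ z → Bm * (Bm * z) * 3ᵐ * (N' ^ 23 * 5ᵐ ^ 23)) c25 ⟩
    Bm * (Bm * (c * c * c ^ 23)) * 3ᵐ * (N' ^ 23 * 5ᵐ ^ 23)
  ≡⟨ pair-c Bm c c (c ^ 23) 3ᵐ (N' ^ 23) (5ᵐ ^ 23) ⟩
    (Bm * c) * (Bm * c) * (c ^ 23 * N' ^ 23) * 5ᵐ ^ 23 * 3ᵐ
  ≡⟨ cong (λ z → (Bm * c) * (Bm * c) * z * 5ᵐ ^ 23 * 3ᵐ) (sym (^-distribʳ-* c N' 23)) ⟩
    (Bm * c) * (Bm * c) * (c * N') ^ 23 * 5ᵐ ^ 23 * 3ᵐ
  ≤⟨ *-monoˡ-≤ 3ᵐ (*-monoˡ-≤ (5ᵐ ^ 23) (*-mono-≤ (≤-reflexive (cong₂ _*_ ea ea)) (^-monoˡ-≤ 23 ec))) ⟩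
    (F * Bb) * (F * Bb) * (F * Z) ^ 23 * 5ᵐ ^ 23 * 3ᵐ
  ≡⟨ square-FB F Bb ((F * Z) ^ 23) (5ᵐ ^ 23) 3ᵐ ⟩
    (F * F) * (Bb * Bb) * (F * Z) ^ 23 * 5ᵐ ^ 23 * 3ᵐ
  ≡⟨ cong (λ z → (F * F) * (Bb * Bb) * z * 5ᵐ ^ 23 * 3ᵐ) (^-distribʳ-* F Z 23) ⟩
    (F * F) * (Bb * Bb) * (F ^ 23 * Z ^ 23) * 5ᵐ ^ 23 * 3ᵐ
  ≡⟨ swap-5Z (F * F) (Bb * Bb) (F ^ 23) (Z ^ 23) (5ᵐ ^ 23) 3ᵐ ⟩
    (F * F) * (Bb * Bb) * F ^ 23 * (5ᵐ ^ 23 * Z ^ 23) * 3ᵐ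
  ≡⟨ cong (λ z → (F * F) * (Bb * Bb) * F ^ 23 * z * 3ᵐ) (sym (^-distribʳ-* 5ᵐ Z 23)) ⟩
    (F * F) * (Bb * Bb) * F ^ 23 * (5ᵐ * Z) ^ 23 * 3ᵐ
  ≤⟨ *-monoˡ-≤ 3ᵐ (*-mono-≤ (*-monoˡ-≤ (F ^ 23) (*-monoʳ-≤ (F * F) (*-mono-≤ h2 h2))) (^-monoˡ-≤ 23 h1)) ⟩
    (F * F) * (q * q) * F ^ 23 * (4ᵐ * N') ^ 23 * 3ᵐ
  ≡⟨ cong (λ z → (F * F) * (q * q) * F ^ 23 * z * 3ᵐ) (^-distribʳ-* 4ᵐ N' 23) ⟩
    (F * F) * (q * q) * F ^ 23 * (4ᵐ ^ 23 * N' ^ 23) * 3ᵐ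
  ≡⟨ regroup-N (F * F) (F ^ 23) q (4ᵐ ^ 23) (N' ^ 23) 3ᵐ ⟩
    (F * F) * F ^ 23 * N' ^ 23 * (q * q * 4ᵐ ^ 23 * 3ᵐ)
  ≤⟨ *-monoʳ-≤ ((F * F) * F ^ 23 * N' ^ 23) h3 ⟩
    (F * F) * F ^ 23 * N' ^ 23 * (2ᵐ * 5ᵐ ^ 23)
  ≡⟨ swap-N ((F * F) * F ^ 23) (N' ^ 23) 2ᵐ (5ᵐ ^ 23) ⟩
    (F * F) * F ^ 23 * 2ᵐ * (N' ^ 23 * 5ᵐ ^ 23)
  ≡⟨ cong (λ z → z * 2ᵐ * (N' ^ 23 * 5ᵐ ^ 23)) (sym F25) ⟩
    F ^ 25 * 2ᵐ * (N' ^ 23 * 5ᵐ ^ 23) ∎)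
  where
  open ≤-Reasoning
  pair-c : ∀ a b c d e f g → a * (a * (c * c * d)) * e * (f * g) ≡ (a * c) * (a * c) * (d * f) * g * e
  pair-c = solve-∀
  square-FB : ∀ F B X P e → (F * B) * (F * B) * X * P * e ≡ (F * F) * (B * B) * X * P * e
  square-FB = solve-∀
  regroup-N : ∀ F2 F23 q 4ᵐ N 3ᵐ → F2 * (q * q) * F23 * (4ᵐ * N) * 3ᵐ ≡ F2 * F23 * N * (q * q * 4ᵐ * 3ᵐ)
  regroup-N = solve-∀
  swap-N : ∀ G N 2ᵐ 5ᵐ → G * N * (2ᵐ * 5ᵐ) ≡ G * 2ᵐ * (N * 5ᵐ)
  swap-N = solve-∀
  sq : ∀ x → x * (x * 1) ≡ x * x
  sq = solve-∀
  c25 : c ^ 25 ≡ c * c * c ^ 23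
  c25 = trans (^-distribˡ-+-* c 2 23) (cong (_* c ^ 23) (sq c))
  F25 : F ^ 25 ≡ (F * F) * F ^ 23
  F25 = trans (^-distribˡ-+-* F 2 23) (cong (_* F ^ 23) (sq F))
  swap-5Z : ∀ a b f z p e → a * b * (f * z) * p * e ≡ a * b * f * (p * z) * e
  swap-5Z = solve-∀

^-comm-exponents : ∀ a k m → (a ^ m) ^ k ≡ (a ^ k) ^ m
^-comm-exponents a k m = trans (^-*-assoc a m k) (trans (cong (a ^_) (*-comm m k)) (sym (^-*-assoc a k m)))

sparse-constants : ∀ m → 10 ^ m * 10 ^ m * (4 ^ m) ^ 23 * 3 ^ m ≤ 2 ^ m * (5 ^ m) ^ 23
sparse-constants m = begin
    10 ^ m * 10 ^ m * (4 ^ m) ^ 23 * 3 ^ m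
  ≡⟨ cong₂ (λ a b → a * b * 3 ^ m) (sym (^-distribʳ-* 10 10 m)) (^-comm-exponents 4 23 m) ⟩
    (10 * 10) ^ m * (4 ^ 23) ^ m * 3 ^ m
  ≡⟨ cong (_* 3 ^ m) (sym (^-distribʳ-* (10 * 10) (4 ^ 23) m)) ⟩
    (10 * 10 * 4 ^ 23) ^ m * 3 ^ m
  ≡⟨ sym (^-distribʳ-* (10 * 10 * 4 ^ 23) 3 m) ⟩
    (10 * 10 * 4 ^ 23 * 3) ^ m
  ≤⟨ ^-monoˡ-≤ m (≤ᵇ-true⇒≤ (10 * 10 * 4 ^ 23 * 3) (2 * 5 ^ 23) refl) ⟩
    (2 * 5 ^ 23) ^ m
  ≡⟨ ^-distribʳ-* 2 (5 ^ 23) m ⟩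
    2 ^ m * (5 ^ 23) ^ m
  ≡⟨ cong (2 ^ m *_) (sym (^-comm-exponents 5 23 m)) ⟩
    2 ^ m * (5 ^ m) ^ 23 ∎
  where open ≤-Reasoning

sparse-term-bound : ∀ n → 1 ≤ n → Σ₃ n * 3 ^ ⌈ n /5⌉ ≤ (n !) ^ 25 * 2 ^ ⌈ n /5⌉
sparse-term-bound n 1≤n = sparse-inequality (choose n m) (sparseCount n m) (n !) (choose (n ∸ m) m) (n ^ m) ((n ∸ m) ^ m) (5 ^ m) (4 ^ m) (10 ^ m) (3 ^ m) (2 ^ m)
  choose*sparseCount sparseCount*nᵐ≤ 5ᵐ[n∸m]ᵐ≤4ᵐnᵐ choose≤10ᵐ (sparse-constants m) (≤-trans (≤-reflexive (sym (^-zeroˡ m))) (^-monoˡ-≤ m 1≤n)) (^-monoʳ-≤ 5 {0} {m} z≤n)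
  where
  m = ⌈ n /5⌉
  m≤n : m ≤ n
  m≤n = ⌈n/5⌉-least n n (m≤n*m n 5)
  choose*sparseCount : choose n m * sparseCount n m ≡ n ! * choose (n ∸ m) m
  choose*sparseCount = choose*falling*! n m (n ∸ m) m≤n
  sparseCount*nᵐ≤ : sparseCount n m * n ^ m ≤ n ! * (n ∸ m) ^ m
  sparseCount*nᵐ≤ = falling*!*^≤!*^ n m (n ∸ m) (m∸n≤m n m) m≤n
  5[n∸m]≤4n : 5 * (n ∸ m) ≤ 4 * n
  5[n∸m]≤4n = begin
      5 * (n ∸ m)
    ≡⟨ *-distribˡ-∸ 5 n m ⟩
      5 * n ∸ 5 * m
    ≤⟨ ∸-monoʳ-≤ (5 * n) (n≤5*⌈n/5⌉ n) ⟩
      n + 4 * n ∸ n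
    ≡⟨ m+n∸m≡n n (4 * n) ⟩
      4 * n ∎
    where open ≤-Reasoning
  5ᵐ[n∸m]ᵐ≤4ᵐnᵐ : 5 ^ m * (n ∸ m) ^ m ≤ 4 ^ m * n ^ m
  5ᵐ[n∸m]ᵐ≤4ᵐnᵐ = ≤-trans (≤-reflexive (sym (^-distribʳ-* 5 (n ∸ m) m))) (≤-trans (^-monoˡ-≤ m 5[n∸m]≤4n) (≤-reflexive (^-distribʳ-* 4 n m)))
  choose≤10ᵐ : choose (n ∸ m) m ≤ 10 ^ m
  choose≤10ᵐ = ≤-trans (choose-monoˡ-≤ (n ∸ m) (4 * m) m (≤-trans (∸-monoˡ-≤ m (n≤5*⌈n/5⌉ n)) (≤-reflexive (m+n∸m≡n m (4 * m))))) (choose-4m-m≤10^m m)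

expansion-sum-bound : ∀ n → Σ₁ n * n ^ 3 ≤ 64 * (n !) ^ 25
expansion-sum-bound n = ≤-trans (≤-reflexive (sumBelow-*ʳ g (n ^ 3) (suc n))) (geometric-bound (λ s → g s * n ^ 3) (64 * (n !) ^ 25) refl hf n)
  where
  g : ℕ → ℕ
  g s = 𝟙 (sizeInRange n s) * (choose n s * (choose n (2 * s ∸ 1) * expansionCount n s ^ 25))
  hf : ∀ s → g s * n ^ 3 * 2 ^ s ≤ 64 * (n !) ^ 25
  hf s with sizeInRange n s in e
  ... | false = z≤n
  ... | true = subst (λ z → z * n ^ 3 * 2 ^ s ≤ 64 * (n !) ^ 25) (sym (+-identityʳ (choose n s * (choose n (2 * s ∸ 1) * expansionCount n s ^ 25))))
          (expansion-term-bound n s (≤ᵇ-true⇒≤ 1 s (∧-elimˡ e)) (≤ᵇ-true⇒≤ (4 * s) n (∧-elimʳ {1 ≤ᵇ s} e)))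

Σ₂≡Σ₁ : ∀ n → Σ₂ n ≡ Σ₁ n
Σ₂≡Σ₁ n = sumBelow-cong _ _ (suc n) h
  where
  h : ∀ s → 𝟙 (sizeInRange n s) * (choose n s * (choose n (2 * s ∸ 1) * expansionCount′ n s ^ 25)) ≡ 𝟙 (sizeInRange n s) * (choose n s * (choose n (2 * s ∸ 1) * expansionCount n s ^ 25))
  h s with sizeInRange n s in e
  ... | false = refl
  ... | true = cong (λ z → 1 * (choose n s * (choose n (2 * s ∸ 1) * z ^ 25))) (expansionCount′≡expansionCount n s s1 tn)
    where
    s1 = ≤ᵇ-true⇒≤ 1 s (∧-elimˡ e)
    h4 = ≤ᵇ-true⇒≤ (4 * s) n (∧-elimʳ {1 ≤ᵇ s} e)
    tn : 2 * s ∸ 1 ≤ n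
    tn = ≤-trans (m∸n≤m (2 * s) 1) (≤-trans (*-monoˡ-≤ s {2} {4} (s≤s (s≤s z≤n))) h4)

expansion-part : ∀ K n → 256 * K ≤ n → 4 * K * n ^ 2 * Σ₁ n ≤ (n !) ^ 25
expansion-part K n 256K≤n = *-cancelˡ-≤ 64 (begin
    64 * (4 * K * n ^ 2 * Σ₁ n)
  ≡⟨ regroup K (n ^ 2) (Σ₁ n) ⟩
    256 * K * n ^ 2 * Σ₁ n
  ≤⟨ *-monoˡ-≤ (Σ₁ n) (*-monoˡ-≤ (n ^ 2) 256K≤n) ⟩
    n ^ 3 * Σ₁ n
  ≡⟨ *-comm (n ^ 3) (Σ₁ n) ⟩
    Σ₁ n * n ^ 3
  ≤⟨ expansion-sum-bound n ⟩
    64 * (n !) ^ 25 ∎)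
  where
  open ≤-Reasoning
  regroup : ∀ K N S → 64 * (4 * K * N * S) ≡ 256 * K * N * S
  regroup = solve-∀

exponential-wins : ∀ K n m → 1050 * K ≤ m → n ≤ 5 * m → 2 * K * n ^ 2 * 2 ^ m ≤ 3 ^ m
exponential-wins K n m 1050K≤m n≤5m = *-cancelˡ-≤ 21 (begin
    21 * (2 * K * n ^ 2 * 2 ^ m)
  ≤⟨ *-monoʳ-≤ 21 (*-monoˡ-≤ (2 ^ m) (*-monoʳ-≤ (2 * K) n²≤25m²)) ⟩
    21 * (2 * K * (25 * (m * m)) * 2 ^ m)
  ≡⟨ regroup K (m * m) (2 ^ m) ⟩
    1050 * K * (m * m * 2 ^ m)
  ≤⟨ *-monoˡ-≤ (m * m * 2 ^ m) 1050K≤m ⟩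
    m * (m * m * 2 ^ m)
  ≡⟨ to-cube m (2 ^ m) ⟩
    2 ^ m * cube m
  ≤⟨ 2^m*m³≤21*3^m m ⟩
    21 * 3 ^ m ∎)
  where
  open ≤-Reasoning
  n²≤25m² : n ^ 2 ≤ 25 * (m * m)
  n²≤25m² = begin
    n * (n * 1)          ≡⟨ cong (n *_) (*-identityʳ n) ⟩
    n * n                ≤⟨ *-mono-≤ n≤5m n≤5m ⟩
    5 * m * (5 * m)      ≡⟨ square-5m m ⟩
    25 * (m * m)         ∎
    where
    square-5m : ∀ m → 5 * m * (5 * m) ≡ 25 * (m * m)
    square-5m = solve-∀
  regroup : ∀ K M P → 21 * (2 * K * (25 * M) * P) ≡ 1050 * K * (M * P)
  regroup = solve-∀
  to-cube : ∀ m P → m * (m * m * P) ≡ P * (m * m * m)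
  to-cube = solve-∀

sparse-part : ∀ K n → 5250 * K ≤ n → 1 ≤ n → 2 * K * n ^ 2 * Σ₃ n ≤ (n !) ^ 25
sparse-part K n 5250K≤n 1≤n = *-cancelʳ-≤ _ _ (3 ^ m) {{>-nonZero (^-monoʳ-≤ 3 {0} {m} z≤n)}} (begin
    2 * K * n ^ 2 * Σ₃ n * 3 ^ m
  ≡⟨ *-assoc (2 * K * n ^ 2) (Σ₃ n) (3 ^ m) ⟩
    2 * K * n ^ 2 * (Σ₃ n * 3 ^ m)
  ≤⟨ *-monoʳ-≤ (2 * K * n ^ 2) (sparse-term-bound n 1≤n) ⟩
    2 * K * n ^ 2 * ((n !) ^ 25 * 2 ^ m)
  ≡⟨ swap (2 * K * n ^ 2) ((n !) ^ 25) (2 ^ m) ⟩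
    (n !) ^ 25 * (2 * K * n ^ 2 * 2 ^ m)
  ≤⟨ *-monoʳ-≤ ((n !) ^ 25) (exponential-wins K n m 1050K≤m (n≤5*⌈n/5⌉ n)) ⟩
    (n !) ^ 25 * 3 ^ m ∎)
  where
  open ≤-Reasoning
  m = ⌈ n /5⌉
  1050K≤m : 1050 * K ≤ m
  1050K≤m = *-cancelˡ-≤ 5 (≤-trans (≤-reflexive (sym (*-assoc 5 1050 K))) (≤-trans 5250K≤n (n≤5*⌈n/5⌉ n)))
  swap : ∀ X F P → X * (F * P) ≡ F * (X * P)
  swap = solve-∀

badCount≤2Σ₁+Σ₃ : ∀ n → badCount n ≤ Σ₁ n + Σ₁ n + Σ₃ n
badCount≤2Σ₁+Σ₃ n = ≤-trans (badCount≤Σ n) (≤-reflexive (cong (λ z → Σ₁ n + z + Σ₃ n) (Σ₂≡Σ₁ n)))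

lemma3p44 : (k : ℕ) → ∃ λ N → (n : ℕ) → N ≤ n →
    suc k * (badCount n * n ^ 2) ≤ totalCount n
lemma3p44 k = 5250 * K , bound
  where
  K = suc k
  bound : ∀ n → 5250 * K ≤ n → K * (badCount n * n ^ 2) ≤ totalCount n
  bound n 5250K≤n = *-cancelˡ-≤ 4 (begin
      4 * (K * (badCount n * n ^ 2))
    ≤⟨ *-monoʳ-≤ 4 (*-monoʳ-≤ K (*-monoˡ-≤ (n ^ 2) (badCount≤2Σ₁+Σ₃ n))) ⟩
      4 * (K * ((Σ₁ n + Σ₁ n + Σ₃ n) * n ^ 2))
    ≡⟨ split K (Σ₁ n) (Σ₃ n) (n ^ 2) ⟩
      2 * (4 * K * n ^ 2 * Σ₁ n) + 2 * (2 * K * n ^ 2 * Σ₃ n)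
    ≤⟨ +-mono-≤ (*-monoʳ-≤ 2 (expansion-part K n (≤-trans (*-monoˡ-≤ K {256} {5250} (≤ᵇ-true⇒≤ 256 5250 refl)) 5250K≤n)))
                (*-monoʳ-≤ 2 (sparse-part K n 5250K≤n (≤-trans (m≤m+n 1 _) 5250K≤n))) ⟩
      2 * (n !) ^ 25 + 2 * (n !) ^ 25
    ≡⟨ cong (λ t → 2 * t + 2 * t) (totalCount≡ n) ⟨
      2 * totalCount n + 2 * totalCount n
    ≡⟨ double (totalCount n) ⟩
      4 * totalCount n ∎)
    where
    open ≤-Reasoning
    split : ∀ K S Y N → 4 * (K * ((S + S + Y) * N)) ≡ 2 * (4 * K * N * S) + 2 * (2 * K * N * Y)
    split = solve-∀
    double : ∀ T → 2 * T + 2 * T ≡ 4 * T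
    double = solve-∀
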